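{- Let $r\ge1$ be an integer, let $G$ be an $r$-regular graph on $n$ vertices, and let $q\ge 1$ be an integer. Then \begin{align*} \chi(\mathcal{N}(G);q)&\le \chi(\mathcal{N}(K_{r,r});q)^{n/(2r)}=(q^r-q)^{n/r},\\ \chi(\mathcal{N}_c(G);q)&\le \chi(\mathcal{N}_c(K_{r+1});q)^{n/(r+1)}=(q^{r+1}-q)^{n/(r+1)},\\ \breve{\chi}(\mathcal{N}(G);q)&\le \breve{\chi}(\mathcal{N}(K_{r,r});q)^{n/(2r)}=\bigl(q(q-1)\cdots(q-r+1)\bigr)^{n/r},\\ \breve{\chi}(\mathcal{N}_c(G);q)&\le \breve{\chi}(\mathcal{N}_c(K_{r+1});q)^{n/(r+1)}=\bigl(q(q-1)\cdots(q-r)\bigr)^{n/(r+1)}. \end{align*}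
   Context: All graphs are finite and simple. For a graph $G$, $\mathcal{N}(G)$ is the hypergraph on vertex set $V(G)$ whose edges are the open neighborhoods $N(v)$, $v\in V(G)$ (counted as a multiset of edges), and $\mathcal{N}_c(G)$ is the hypergraph on $V(G)$ whose edges are the closed neighborhoods $N[v]=N(v)\cup\{v\}$, $v\in V(G)$. A $q$-coloring of a hypergraph is a map from its vertex set to $\{1,\dots,q\}$; it is proper if no edge is monochromatic, and rainbow if no edge contains two vertices of the same color. $\chi(\mathcal{H};q)$ is the number of proper $q$-colorings of $\mathcal{H}$ and $\breve{\chi}(\mathcal{H};q)$ is the number of rainbow $q$-colorings of $\mathcal{H}$. $K_{r,r}$ is the complete bipartite graph with parts of size $r$ and $K_{r+1}$ the complete graph on $r+1$ vertices. -}

module Defs where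

open import Data.Nat using (ℕ; zero; suc; _∸_; _*_; _<?_)
open import Data.Bool using (Bool; true; false; not; _xor_)
open import Data.Bool.Properties using (xor-same; xor-comm)
open import Data.Fin using (Fin; toℕ; _≟_)
open import Data.Fin.Properties using (all?)
open import Data.Fin.Subset using (Subset; _∈_; ∣_∣; outside; inside)
open import Data.Fin.Subset.Properties using (_∈?_)
open import Data.Vec using (tabulate; _[_]≔_)
import Data.Vec.Functional as VF
open import Data.List using (List; []; _∷_; map; concatMap; length; filter)
open import Data.List.Relation.Unary.All using (All)
import Data.List.Relation.Unary.All as All
open import Data.Empty using (⊥-elim)
open import Relation.Nullary using (Dec; yes; no; ¬_; ¬?; does)
open import Relation.Nullary.Decidable using (_→-dec_)
open import Relation.Binary.PropositionalEquality using (_≡_; refl)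

record Graph (n : ℕ) : Set where
  field
    adj     : Fin n → Fin n → Bool
    adj-sym : ∀ i j → adj i j ≡ adj j i
    irrefl  : ∀ i → adj i i ≡ false
open Graph public

N : ∀ {n} → Graph n → Fin n → Subset n
N G v = tabulate (adj G v)

Nc : ∀ {n} → Graph n → Fin n → Subset n
Nc G v = N G v [ v ]≔ inside

Regular : ∀ {n} → ℕ → Graph n → Set
Regular {n} r G = ∀ (v : Fin n) → ∣ N G v ∣ ≡ r

-- Hypergraphs on Fin n: a multiset (list) of edges, each a subset

Hypergraph : ℕ → Set
Hypergraph n = List (Subset n)


𝒩 : ∀ {n} → Graph n → Hypergraph n
𝒩 {n} G = map (N G) (Data.List.allFin n)
  where import Data.List

𝒩c : ∀ {n} → Graph n → Hypergraph n
𝒩c {n} G = map (Nc G) (Data.List.allFin n)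
  where import Data.List

Coloring : ℕ → ℕ → Set
Coloring n q = Fin n → Fin q

Monochromatic : ∀ {n q} → Coloring n q → Subset n → Set
Monochromatic c e = ∀ u w → u ∈ e → w ∈ e → c u ≡ c w

RainbowEdge : ∀ {n q} → Coloring n q → Subset n → Set
RainbowEdge c e = ∀ u w → u ∈ e → w ∈ e → ¬ (u ≡ w) → ¬ (c u ≡ c w)

Proper : ∀ {n q} → Hypergraph n → Coloring n q → Set
Proper H c = All (λ e → ¬ Monochromatic c e) H

Rainbow : ∀ {n q} → Hypergraph n → Coloring n q → Set
Rainbow H c = All (RainbowEdge c) H

mono? : ∀ {n q} (c : Coloring n q) (e : Subset n) → Dec (Monochromatic c e)
mono? c e = all? λ u → all? λ w → (u ∈? e) →-dec ((w ∈? e) →-dec (c u ≟ c w))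

rainbowEdge? : ∀ {n q} (c : Coloring n q) (e : Subset n) → Dec (RainbowEdge c e)
rainbowEdge? c e = all? λ u → all? λ w →
  (u ∈? e) →-dec ((w ∈? e) →-dec (¬? (u ≟ w) →-dec ¬? (c u ≟ c w)))

proper? : ∀ {n q} (H : Hypergraph n) (c : Coloring n q) → Dec (Proper H c)
proper? H c = All.all? (λ e → ¬? (mono? c e)) H

rainbow? : ∀ {n q} (H : Hypergraph n) (c : Coloring n q) → Dec (Rainbow H c)
rainbow? H c = All.all? (rainbowEdge? c) H

-- list of all q-colourings Fin n → Fin q (each exactly once)
allColorings : (n q : ℕ) → List (Coloring n q)
allColorings zero    q = (λ ()) ∷ []
allColorings (suc n) q =
  concatMap (λ a → map (λ f → a VF.∷ f) (allColorings n q)) (Data.List.allFin q)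
  where import Data.List

χ : ∀ {n} → Hypergraph n → ℕ → ℕ
χ {n} H q = length (filter (proper? H) (allColorings n q))

χ˘ : ∀ {n} → Hypergraph n → ℕ → ℕ
χ˘ {n} H q = length (filter (rainbow? H) (allColorings n q))

-- Complete bipartite graph K_{r,r} on Fin (r + r): parts {i < r}, {i ≥ r}

side : ∀ {m} → ℕ → Fin m → Bool
side r i = does (toℕ i <? r)

Kbip : (r : ℕ) → Graph (r Data.Nat.+ r)
Kbip r = record
  { adj     = λ i j → side r i xor side r j
  ; adj-sym = λ i j → xor-comm (side r i) (side r j)
  ; irrefl  = λ i → xor-same (side r i)
  }
  where import Data.Nat

Kₙ : (m : ℕ) → Graph m
Kₙ m = record { adj = adjK ; adj-sym = symK ; irrefl = irrK }
  where
  adjK : Fin m → Fin m → Bool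
  adjK i j = not (does (i ≟ j))
  irrK : ∀ i → adjK i i ≡ false
  irrK i with i ≟ i
  ... | yes _ = refl
  ... | no p  = ⊥-elim (p refl)
  symK : ∀ i j → adjK i j ≡ adjK j i
  symK i j with i ≟ j | j ≟ i
  ... | yes _ | yes _ = refl
  ... | no _  | no _  = refl
  ... | yes p | no q  = ⊥-elim (q (Relation.Binary.PropositionalEquality.sym p))
  ... | no p  | yes q = ⊥-elim (p (Relation.Binary.PropositionalEquality.sym q))

-- falling factorial q (q-1) ... (q-k+1)  (k factors; truncated subtraction)

fall : ℕ → ℕ → ℕ
fall q zero    = 1
fall q (suc k) = fall q k * (q ∸ k)

-- A colouring is counted by χ(𝒩(G); q) iff for every
-- vertex v it passes a test ("N(v) is not monochromatic"; for χ˘: "N(v) is rainbow")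
-- that only looks at the colours inside N(v), and every vertex lies in exactly r of the
-- sets N(v) (in r + 1 of the closed neighbourhoods N[v]).  Finner's generalisation of
-- Hölder's inequality, i.e. the counting form of Shearer's lemma, then gives
--   χ(𝒩(G); q)^r ≤ ∏_v #{colourings of N(v) passing its test} = (q^r - q)^n,
-- and likewise (q (q-1) ⋯ (q-r+1))^n for χ˘ and the bounds with r + 1 for 𝒩_c.  These
-- right-hand sides are exactly the values for K_{r,r} (two disjoint edges of size r, each
-- repeated r times) and K_{r+1} (one edge of size r + 1, repeated r + 1 times).
module Submission where

open import Data.Nat using (ℕ; zero; suc; _+_; _*_; _∸_; _^_; _≤_; z≤n; s≤s; NonZero)
open import Data.Nat.Properties
open import Data.Nat.ListAction using (sum; product)
open import Data.Nat.Tactic.RingSolver using (solve-∀)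
open import Data.Bool using (Bool; true; false; not; _∧_; _∨_; _xor_)
import Data.Bool.Properties as Boolₚ
open import Data.Fin using (Fin; zero; suc; _↑ʳ_)
import Data.Fin as Fin
import Data.Fin.Properties as Finₚ
open import Data.Fin.Subset using (Subset; ∣_∣; _∈_)
import Data.Fin.Subset.Properties as Subsetₚ
open import Data.List using (List; []; _∷_; map; length; zipWith; filter; allFin)
import Data.List as List
import Data.List.Properties as Listₚ
open import Data.List.Relation.Unary.All using (All; []; _∷_)
import Data.List.Relation.Unary.All as All
import Data.List.Relation.Unary.All.Properties as Allₚ
open import Data.Vec using (Vec; []; _∷_; there; lookup; replicate; tabulate; _[_]≔_)
import Data.Vec.Properties as Vecₚ
open import Data.Vec.Functional using () renaming (_∷_ to _∷ᶠ_)
open import Data.Product using (_×_; _,_; proj₁; proj₂)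
open import Data.Sum using (_⊎_; inj₁; inj₂)
open import Data.Empty using (⊥-elim)
open import Function using (_∘_; id)
open import Relation.Nullary using (¬_; Dec; yes; no; does; ¬?)
open import Relation.Nullary.Decidable using (_→-dec_; _×-dec_)
open import Relation.Binary.PropositionalEquality
open import Defs

^-distribʳ-* : ∀ a b k → (a * b) ^ k ≡ a ^ k * b ^ k
^-distribʳ-* a b zero    = refl
^-distribʳ-* a b (suc k) rewrite ^-distribʳ-* a b k = swap-middle a b (a ^ k) (b ^ k)
  where
  swap-middle : ∀ a b x y → a * b * (x * y) ≡ a * x * (b * y)
  swap-middle = solve-∀

-- Rearrangement inequality for the similarly ordered pairs (x, y) and (x^m, y^m),
-- first when x ≤ y (write y = x + d and y^m = x^m + e; the defect is d * e) ...
rearrangement-≤ : ∀ m x y → x ≤ y → x * y ^ m + x ^ m * y ≤ x * x ^ m + y * y ^ m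
rearrangement-≤ m x y x≤y with m≤n⇒∃[o]m+o≡n x≤y
... | d , refl with m≤n⇒∃[o]m+o≡n (^-monoˡ-≤ m x≤y)
... | e , eq rewrite sym eq =
  subst (x * (x ^ m + e) + x ^ m * (x + d) ≤_) (expand x d (x ^ m) e) (m≤m+n _ (d * e))
  where
  expand : ∀ x d X e → x * (X + e) + X * (x + d) + d * e ≡ x * X + (x + d) * (X + e)
  expand = solve-∀

rearrangement : ∀ m x y → x * y ^ m + x ^ m * y ≤ x * x ^ m + y * y ^ m
rearrangement m x y with ≤-total x y
... | inj₁ x≤y = rearrangement-≤ m x y x≤y
... | inj₂ y≤x = subst₂ _≤_ (swap y x (y ^ m) (x ^ m)) (+-comm (y * y ^ m) (x * x ^ m))
                   (rearrangement-≤ m y x y≤x)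
  where
  swap : ∀ y x Y X → y * X + Y * x ≡ x * Y + X * y
  swap = solve-∀

tangent-line : ∀ j x y → suc j * x ^ j * y ≤ y ^ suc j + j * x ^ suc j
tangent-line zero x y = ≤-reflexive (base x y)
  where
  base : ∀ x y → (1 + 0) * 1 * y ≡ y * 1 + 0 * (x * 1)
  base = solve-∀
tangent-line (suc j) x y = begin
  suc (suc j) * (x * x ^ j) * y                   ≡⟨ e₁ j x (x ^ j) y ⟩
  x * (suc j * x ^ j * y) + x * x ^ j * y         ≤⟨ +-monoˡ-≤ _ (*-monoʳ-≤ x (tangent-line j x y)) ⟩
  x * (y ^ suc j + j * x ^ suc j) + x * x ^ j * y ≡⟨ e₂ j x (x ^ j) y (y ^ suc j) ⟩
  (x * y ^ suc j + x ^ suc j * y) + j * X²        ≤⟨ +-monoˡ-≤ _ (rearrangement (suc j) x y) ⟩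
  (x * x ^ suc j + y * y ^ suc j) + j * X²        ≡⟨ e₃ j x (x ^ j) y (y ^ suc j) ⟩
  y * y ^ suc j + suc j * X²                      ∎
  where
  open ≤-Reasoning
  X² : ℕ
  X² = x * (x * x ^ j)
  e₁ : ∀ j x X y → (2 + j) * (x * X) * y ≡ x * ((1 + j) * X * y) + x * X * y
  e₁ = solve-∀
  e₂ : ∀ j x X y Y → x * (Y + j * (x * X)) + x * X * y ≡ (x * Y + (x * X) * y) + j * (x * (x * X))
  e₂ = solve-∀
  e₃ : ∀ j x X y Y → (x * (x * X) + y * Y) + j * (x * (x * X)) ≡ y * Y + (1 + j) * (x * (x * X))
  e₃ = solve-∀

-- The inductive step of AM–GM:  (k+1)^(k+1) S^k t ≤ k^k (S + t)^(k+1) for k ≥ 1,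
-- i.e. the tangent-line inequality at x = (k+1) S, y = k (S + t), cancelled by k.
amgm-step : ∀ k S t → 1 ≤ k → suc k ^ suc k * S ^ k * t ≤ k ^ k * (S + t) ^ suc k
amgm-step k@(suc _) S t _ = *-cancelˡ-≤ k (+-cancelʳ-≤ C _ _ scaled)
  where
  m : ℕ
  m = suc k
  C : ℕ
  C = k * ((m * m ^ k) * S * S ^ k)
  tangent : suc k * (m * S) ^ k * (k * (S + t)) ≤ (k * (S + t)) ^ suc k + k * (m * S) ^ suc k
  tangent = tangent-line k (m * S) (k * (S + t))
  lhs : ∀ k mk SK S t → suc k * (mk * SK) * (k * (S + t))
                        ≡ k * ((suc k * mk) * SK * t) + k * ((suc k * mk) * S * SK)
  lhs = solve-∀
  rhs : ∀ k kk T mk S SK → k * kk * T + k * ((suc k * mk) * (S * SK))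
                           ≡ k * (kk * T) + k * ((suc k * mk) * S * SK)
  rhs = solve-∀
  scaled : k * ((m * m ^ k) * S ^ k * t) + C ≤ k * (k ^ k * (S + t) ^ suc k) + C
  scaled rewrite sym (lhs k (m ^ k) (S ^ k) S t)
               | sym (rhs k (k ^ k) ((S + t) ^ suc k) (m ^ k) S (S ^ k))
               | sym (^-distribʳ-* m S k) | sym (^-distribʳ-* k (S + t) (suc k))
               | sym (^-distribʳ-* m S (suc k)) = tangent

amgm : ∀ ts → length ts ^ length ts * product ts ≤ sum ts ^ length ts
amgm []       = ≤-refl
amgm (t ∷ []) = ≤-reflexive (single t)
  where
  single : ∀ t → 1 * (t * 1) ≡ (t + 0) * 1
  single = solve-∀
amgm (t ∷ ts@(_ ∷ _)) = *-cancelˡ-≤ (k ^ k) {{m^n≢0 k k}} (begin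
  k ^ k * (m ^ m * (t * Π))  ≡⟨ e₁ (k ^ k) (m ^ m) t Π ⟩
  m ^ m * t * (k ^ k * Π)    ≤⟨ *-monoʳ-≤ (m ^ m * t) (amgm ts) ⟩
  m ^ m * t * S ^ k          ≡⟨ e₂ (m ^ m) t (S ^ k) ⟩
  m ^ m * S ^ k * t          ≤⟨ amgm-step k S t (s≤s z≤n) ⟩
  k ^ k * (S + t) ^ m        ≡⟨ cong (λ z → k ^ k * z ^ m) (+-comm S t) ⟩
  k ^ k * (t + S) ^ m        ∎)
  where
  open ≤-Reasoning
  k : ℕ
  k = length ts
  m : ℕ
  m = suc k
  S : ℕ
  S = sum ts
  Π : ℕ
  Π = product ts
  e₁ : ∀ K M t P → K * (M * (t * P)) ≡ M * t * (K * P)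
  e₁ = solve-∀
  e₂ : ∀ M t SK → M * t * SK ≡ M * SK * t
  e₂ = solve-∀

∑ : (q : ℕ) → (Fin q → ℕ) → ℕ
∑ zero    f = 0
∑ (suc q) f = f zero + ∑ q (f ∘ suc)

∑-cong : ∀ q {f g : Fin q → ℕ} → (∀ a → f a ≡ g a) → ∑ q f ≡ ∑ q g
∑-cong zero    f≗g = refl
∑-cong (suc q) f≗g = cong₂ _+_ (f≗g zero) (∑-cong q (f≗g ∘ suc))

∑-+ : ∀ q (f g : Fin q → ℕ) → ∑ q (λ a → f a + g a) ≡ ∑ q f + ∑ q g
∑-+ zero    f g = refl
∑-+ (suc q) f g rewrite ∑-+ q (f ∘ suc) (g ∘ suc) =
  +-exchange (f zero) (g zero) (∑ q (f ∘ suc)) (∑ q (g ∘ suc))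
  where
  +-exchange : ∀ a b c d → a + b + (c + d) ≡ a + c + (b + d)
  +-exchange = solve-∀

∑-*ʳ : ∀ q (f : Fin q → ℕ) c → ∑ q (λ a → f a * c) ≡ ∑ q f * c
∑-*ʳ zero    f c = refl
∑-*ʳ (suc q) f c rewrite ∑-*ʳ q (f ∘ suc) c = sym (*-distribʳ-+ c (f zero) (∑ q (f ∘ suc)))

∑-*ˡ : ∀ q (f : Fin q → ℕ) c → ∑ q (λ a → c * f a) ≡ c * ∑ q f
∑-*ˡ q f c = trans (∑-cong q (λ a → *-comm c (f a))) (trans (∑-*ʳ q f c) (*-comm (∑ q f) c))

∑-const : ∀ q c → ∑ q (λ _ → c) ≡ q * c
∑-const zero    c = refl
∑-const (suc q) c = cong (c +_) (∑-const q c)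

∑-zero : ∀ q (f : Fin q → ℕ) → (∀ a → f a ≡ 0) → ∑ q f ≡ 0
∑-zero q f f≗0 = trans (∑-cong q f≗0) (trans (∑-const q 0) (*-zeroʳ q))

∑≡0⇒ : ∀ q (f : Fin q → ℕ) → ∑ q f ≡ 0 → ∀ a → f a ≡ 0
∑≡0⇒ (suc q) f ∑≡0 zero    = m+n≡0⇒m≡0 (f zero) ∑≡0
∑≡0⇒ (suc q) f ∑≡0 (suc a) = ∑≡0⇒ q (f ∘ suc) (m+n≡0⇒n≡0 (f zero) ∑≡0) a

-- The mediant inequality without roots: if a/T and b/S are both at most (e/c)^(1/k),
-- then so is (a + b)/(T + S).  First the case a S ≤ b T (a/T ≤ b/S) ...
mediant-≤ : ∀ k a b c e T S → 1 ≤ k → a * S ≤ b * T →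
            a ^ k * c ≤ T ^ k * e → b ^ k * c ≤ S ^ k * e → (a + b) ^ k * c ≤ (T + S) ^ k * e
mediant-≤ k@(suc _) a b c e T zero _ _ ha hb with m*n≡0⇒m≡0∨n≡0 (b ^ k) (n≤0⇒n≡0 hb)
... | inj₂ refl rewrite *-zeroʳ ((a + b) ^ k) = z≤n
... | inj₁ bᵏ≡0 rewrite m^n≡0⇒m≡0 b k bᵏ≡0 | +-identityʳ a | +-identityʳ T = ha
mediant-≤ k a b c e T S@(suc _) _ aS≤bT ha hb = *-cancelˡ-≤ (S ^ k) {{m^n≢0 S k}} (begin
  S ^ k * ((a + b) ^ k * c)  ≡⟨ e₁ (S ^ k) ((a + b) ^ k) c ⟩
  (a + b) ^ k * S ^ k * c    ≡⟨ cong (_* c) (^-distribʳ-* (a + b) S k) ⟨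
  ((a + b) * S) ^ k * c      ≤⟨ *-monoˡ-≤ c (^-monoˡ-≤ k base) ⟩
  (b * (S + T)) ^ k * c      ≡⟨ cong (_* c) (^-distribʳ-* b (S + T) k) ⟩
  b ^ k * (S + T) ^ k * c    ≡⟨ e₂ (b ^ k) c ((S + T) ^ k) ⟩
  b ^ k * c * (S + T) ^ k    ≤⟨ *-monoˡ-≤ ((S + T) ^ k) hb ⟩
  S ^ k * e * (S + T) ^ k    ≡⟨ e₃ (S ^ k) e ((S + T) ^ k) ⟩
  S ^ k * ((S + T) ^ k * e)  ≡⟨ cong (λ z → S ^ k * (z ^ k * e)) (+-comm S T) ⟩
  S ^ k * ((T + S) ^ k * e)  ∎)
  where
  open ≤-Reasoning
  e₁ : ∀ SK AB c → SK * (AB * c) ≡ AB * SK * c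
  e₁ = solve-∀
  e₂ : ∀ BK c ST → BK * ST * c ≡ BK * c * ST
  e₂ = solve-∀
  e₃ : ∀ SK e ST → SK * e * ST ≡ SK * (ST * e)
  e₃ = solve-∀
  split : ∀ a b S → (a + b) * S ≡ a * S + b * S
  split = solve-∀
  merge : ∀ b S T → b * T + b * S ≡ b * (S + T)
  merge = solve-∀
  base : (a + b) * S ≤ b * (S + T)
  base = begin
    (a + b) * S    ≡⟨ split a b S ⟩
    a * S + b * S  ≤⟨ +-monoˡ-≤ (b * S) aS≤bT ⟩
    b * T + b * S  ≡⟨ merge b S T ⟩
    b * (S + T)    ∎

mediant : ∀ k a b c e T S → 1 ≤ k →
          a ^ k * c ≤ T ^ k * e → b ^ k * c ≤ S ^ k * e → (a + b) ^ k * c ≤ (T + S) ^ k * e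
mediant k a b c e T S k≥1 ha hb with ≤-total (a * S) (b * T)
... | inj₁ aS≤bT = mediant-≤ k a b c e T S k≥1 aS≤bT ha hb
... | inj₂ bT≤aS = subst₂ (λ x y → x ^ k * c ≤ y ^ k * e) (+-comm b a) (+-comm S T)
                     (mediant-≤ k b a c e S T k≥1 bT≤aS hb ha)

mediant-∑ : ∀ q k (u T : Fin q → ℕ) c e → 1 ≤ k →
            (∀ a → u a ^ k * c ≤ T a ^ k * e) → ∑ q u ^ k * c ≤ ∑ q T ^ k * e
mediant-∑ zero    (suc k) u T c e _   _     = z≤n
mediant-∑ (suc q) k       u T c e k≥1 bound =
  mediant k (u zero) (∑ q (u ∘ suc)) c e (T zero) (∑ q (T ∘ suc)) k≥1 (bound zero)
    (mediant-∑ q k (u ∘ suc) (T ∘ suc) c e k≥1 (bound ∘ suc))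

-- Leave-one-out products: the j-th entry of  others Xs  is ∏_{i ≠ j} X_i.
-- They are the weights of the weighted AM–GM step in Hölder's inequality.
others : List ℕ → List ℕ
others []       = []
others (X ∷ Xs) = product Xs ∷ map (X *_) (others Xs)

length-others : ∀ Xs → length (others Xs) ≡ length Xs
length-others []       = refl
length-others (X ∷ Xs) = cong suc (trans (Listₚ.length-map (X *_) (others Xs)) (length-others Xs))

product-map-* : ∀ X L → product (map (X *_) L) ≡ X ^ length L * product L
product-map-* X []      = refl
product-map-* X (l ∷ L) rewrite product-map-* X L = regroup X l (X ^ length L) (product L)
  where
  regroup : ∀ X l XL PL → X * l * (XL * PL) ≡ X * XL * (l * PL)
  regroup = solve-∀

product-others : ∀ Xs → product (others Xs) * product Xs ≡ product Xs ^ length Xs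
product-others []       = refl
product-others (X ∷ Xs) rewrite product-map-* X (others Xs) | length-others Xs =
  trans (regroup X (product Xs) (X ^ length Xs) (product (others Xs)))
    (trans (cong (λ z → X * X ^ length Xs * (product Xs * z)) (product-others Xs))
           (sym (^-distribʳ-* X (product Xs) (suc (length Xs)))))
  where
  regroup : ∀ X p XL pL → p * (XL * pL) * (X * p) ≡ X * XL * (p * (pL * p))
  regroup = solve-∀

sum-zipWith-map-* : ∀ X Xs L → sum (zipWith _*_ Xs (map (X *_) L)) ≡ X * sum (zipWith _*_ Xs L)
sum-zipWith-map-* X []       L       = sym (*-zeroʳ X)
sum-zipWith-map-* X (x ∷ Xs) []      = sym (*-zeroʳ X)
sum-zipWith-map-* X (x ∷ Xs) (l ∷ L) rewrite sum-zipWith-map-* X Xs L =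
  factor X x l (sum (zipWith _*_ Xs L))
  where
  factor : ∀ X x l s → x * (X * l) + X * s ≡ X * (x * l + s)
  factor = solve-∀

sum-others : ∀ Xs → sum (zipWith _*_ Xs (others Xs)) ≡ length Xs * product Xs
sum-others []       = refl
sum-others (X ∷ Xs) rewrite sum-zipWith-map-* X Xs (others Xs) | sum-others Xs =
  regroup X (product Xs) (length Xs)
  where
  regroup : ∀ X p n → X * p + X * (n * p) ≡ X * p + n * (X * p)
  regroup = solve-∀

product-zipWith-* : ∀ as bs → length as ≡ length bs →
                    product (zipWith _*_ as bs) ≡ product as * product bs
product-zipWith-* []       []       _  = refl
product-zipWith-* (a ∷ as) (b ∷ bs) eq rewrite product-zipWith-* as bs (suc-injective eq) =
  swap-middle a b (product as) (product bs)
  where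
  swap-middle : ∀ a b x y → a * b * (x * y) ≡ a * x * (b * y)
  swap-middle = solve-∀

length-zipWith-* : ∀ as bs → length as ≡ length bs → length (zipWith _*_ as bs) ≡ length as
length-zipWith-* []       []       _  = refl
length-zipWith-* (a ∷ as) (b ∷ bs) eq = cong suc (length-zipWith-* as bs (suc-injective eq))

∑-weighted : ∀ q (ys : List (Fin q → ℕ)) L →
  ∑ q (λ a → sum (zipWith _*_ (map (λ y → y a) ys) L)) ≡ sum (zipWith _*_ (map (∑ q) ys) L)
∑-weighted q []       L       = ∑-zero q _ (λ _ → refl)
∑-weighted q (y ∷ ys) []      = ∑-zero q _ (λ _ → refl)
∑-weighted q (y ∷ ys) (l ∷ L) =
  trans (∑-+ q (λ a → y a * l) (λ a → sum (zipWith _*_ (map (λ y → y a) ys) L)))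
        (cong₂ _+_ (∑-*ʳ q y l) (∑-weighted q ys L))

weighted-amgm : ∀ ys L → length ys ≡ length L →
  length ys ^ length ys * (product ys * product L) ≤ sum (zipWith _*_ ys L) ^ length ys
weighted-amgm ys L same-length
  rewrite sym (product-zipWith-* ys L same-length) | sym (length-zipWith-* ys L same-length) =
  amgm (zipWith _*_ ys L)

holder-pointwise : ∀ k x P Y c T → x ^ k ≤ P * Y → k ^ k * (Y * c) ≤ T ^ k → (k * x) ^ k * c ≤ T ^ k * P
holder-pointwise k x P Y c T x≤ amgm≤ = begin
  (k * x) ^ k * c        ≡⟨ cong (_* c) (^-distribʳ-* k x k) ⟩
  k ^ k * x ^ k * c      ≡⟨ *-assoc (k ^ k) (x ^ k) c ⟩
  k ^ k * (x ^ k * c)    ≤⟨ *-monoʳ-≤ (k ^ k) (*-monoˡ-≤ c x≤) ⟩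
  k ^ k * (P * Y * c)    ≡⟨ regroup (k ^ k) P Y c ⟩
  P * (k ^ k * (Y * c))  ≤⟨ *-monoʳ-≤ P amgm≤ ⟩
  P * T ^ k              ≡⟨ *-comm P (T ^ k) ⟩
  T ^ k * P              ∎
  where
  open ≤-Reasoning
  regroup : ∀ K P Y c → K * (P * Y * c) ≡ P * (K * (Y * c))
  regroup = solve-∀

-- The final step of Hölder's inequality: cancelling k^k and the weights, whose
-- product is c = Π^(k-1), turns (k U)^k c ≤ (k Π)^k P into U^k ≤ P Π.
cancel-weights : ∀ k U Π c P .{{_ : NonZero k}} .{{_ : NonZero Π}} →
                 c * Π ≡ Π ^ k → (k * U) ^ k * c ≤ (k * Π) ^ k * P → U ^ k ≤ P * Π
cancel-weights k U Π c P cΠ≡Πᵏ summed = *-cancelˡ-≤ (k ^ k * Π ^ k) {{m*n≢0 (k ^ k) (Π ^ k) {{m^n≢0 k k}} {{m^n≢0 Π k}}}} (begin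
  k ^ k * Π ^ k * U ^ k    ≡⟨ e₁ (k ^ k) (U ^ k) (Π ^ k) ⟨
  k ^ k * U ^ k * Π ^ k    ≡⟨ cong (k ^ k * U ^ k *_) cΠ≡Πᵏ ⟨
  k ^ k * U ^ k * (c * Π)  ≡⟨ e₂ (k ^ k) (U ^ k) c Π ⟨
  k ^ k * U ^ k * c * Π    ≡⟨ cong (λ z → z * c * Π) (^-distribʳ-* k U k) ⟨
  (k * U) ^ k * c * Π      ≤⟨ *-monoˡ-≤ Π summed ⟩
  (k * Π) ^ k * P * Π      ≡⟨ cong (λ z → z * P * Π) (^-distribʳ-* k Π k) ⟩
  k ^ k * Π ^ k * P * Π    ≡⟨ e₂ (k ^ k) (Π ^ k) P Π ⟩
  k ^ k * Π ^ k * (P * Π)  ∎)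
  where
  open ≤-Reasoning
  e₁ : ∀ K X Y → K * X * Y ≡ K * Y * X
  e₁ = solve-∀
  e₂ : ∀ K X Y Z → K * X * Y * Z ≡ K * X * (Y * Z)
  e₂ = solve-∀

-- First when all X_j = ∑ y_j are nonzero:
-- with the weights L_j = ∏_{i≠j} X_i, weighted AM–GM bounds each k u(a) against
-- T(a) = ∑_j y_j(a) L_j, the mediant inequality sums these bounds, and ∑_a T(a) = k ∏ X.
holder-nonzero : ∀ q k (ys : List (Fin q → ℕ)) (u : Fin q → ℕ) P → length ys ≡ k → 1 ≤ k →
  NonZero (product (map (∑ q) ys)) →
  (∀ a → u a ^ k ≤ P * product (map (λ y → y a) ys)) →
  ∑ q u ^ k ≤ P * product (map (∑ q) ys)
holder-nonzero q k@(suc _) ys u P ∣ys∣≡k k≥1 Π≢0 bound =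
  cancel-weights k (∑ q u) Π c P {{_}} {{Π≢0}} (trans (product-others Xs) (cong (Π ^_) ∣Xs∣≡k)) summed
  where
  Xs : List ℕ
  Xs = map (∑ q) ys
  L : List ℕ
  L = others Xs
  c : ℕ
  c = product L
  Π : ℕ
  Π = product Xs
  column : Fin q → List ℕ
  column a = map (λ y → y a) ys
  T : Fin q → ℕ
  T a = sum (zipWith _*_ (column a) L)
  ∣Xs∣≡k : length Xs ≡ k
  ∣Xs∣≡k = trans (Listₚ.length-map (∑ q) ys) ∣ys∣≡k
  ∣column∣≡k : ∀ a → length (column a) ≡ k
  ∣column∣≡k a = trans (Listₚ.length-map _ ys) ∣ys∣≡k
  weighted : ∀ a → k ^ k * (product (column a) * c) ≤ T a ^ k
  weighted a = subst (λ m → m ^ m * (product (column a) * c) ≤ T a ^ m) (∣column∣≡k a)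
    (weighted-amgm (column a) L (trans (∣column∣≡k a) (sym (trans (length-others Xs) ∣Xs∣≡k))))
  summed : (k * ∑ q u) ^ k * c ≤ (k * Π) ^ k * P
  summed = subst₂ (λ x y → x ^ k * c ≤ y ^ k * P) (∑-*ˡ q u k)
    (trans (∑-weighted q ys L) (trans (sum-others Xs) (cong (_* Π) ∣Xs∣≡k)))
    (mediant-∑ q k (λ a → k * u a) T c P k≥1
      (λ a → holder-pointwise k (u a) P (product (column a)) c (T a) (bound a) (weighted a)))

product-∑≡0 : ∀ q (ys : List (Fin q → ℕ)) → product (map (∑ q) ys) ≡ 0 →
              ∀ a → product (map (λ y → y a) ys) ≡ 0
product-∑≡0 q (y ∷ ys) Π≡0 a with m*n≡0⇒m≡0∨n≡0 (∑ q y) Π≡0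
... | inj₁ ∑y≡0 rewrite ∑≡0⇒ q y ∑y≡0 a = refl
... | inj₂ rest≡0 rewrite product-∑≡0 q ys rest≡0 a = *-zeroʳ (y a)

-- Hölder's inequality in general: the degenerate case forces u ≡ 0.
holder : ∀ q k (ys : List (Fin q → ℕ)) (u : Fin q → ℕ) P → length ys ≡ k → 1 ≤ k →
  (∀ a → u a ^ k ≤ P * product (map (λ y → y a) ys)) →
  ∑ q u ^ k ≤ P * product (map (∑ q) ys)
holder q k@(suc _) ys u P ∣ys∣≡k k≥1 bound with product (map (∑ q) ys) in Π≡
... | suc _ = subst (λ z → ∑ q u ^ k ≤ P * z) Π≡
                (holder-nonzero q k ys u P ∣ys∣≡k k≥1 (subst NonZero (sym Π≡) _) bound)
... | zero  = subst (λ z → z ^ k ≤ P * 0) (sym (∑-zero q u u≡0)) z≤n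
  where
  u≡0 : ∀ a → u a ≡ 0
  u≡0 a = m^n≡0⇒m≡0 (u a) k (n≤0⇒n≡0 (subst (λ z → u a ^ k ≤ z)
            (trans (cong (P *_) (product-∑≡0 q ys Π≡ a)) (*-zeroʳ P)) (bound a)))

-- The indicator of a boolean; counting a decidable property means summing 𝟙 (does _).
𝟙 : Bool → ℕ
𝟙 true  = 1
𝟙 false = 0

∑ˡ : ∀ {A : Set} → List A → (A → ℕ) → ℕ
∑ˡ []       f = 0
∑ˡ (x ∷ xs) f = f x + ∑ˡ xs f

∑ˡ-cong : ∀ {A : Set} (xs : List A) {f g : A → ℕ} → (∀ x → f x ≡ g x) → ∑ˡ xs f ≡ ∑ˡ xs g
∑ˡ-cong []       f≗g = refl
∑ˡ-cong (x ∷ xs) f≗g = cong₂ _+_ (f≗g x) (∑ˡ-cong xs f≗g)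

∑ˡ-++ : ∀ {A : Set} (xs ys : List A) f → ∑ˡ (xs List.++ ys) f ≡ ∑ˡ xs f + ∑ˡ ys f
∑ˡ-++ []       ys f = refl
∑ˡ-++ (x ∷ xs) ys f rewrite ∑ˡ-++ xs ys f = sym (+-assoc (f x) _ _)

∑ˡ-map : ∀ {A B : Set} (h : A → B) (xs : List A) f → ∑ˡ (map h xs) f ≡ ∑ˡ xs (f ∘ h)
∑ˡ-map h []       f = refl
∑ˡ-map h (x ∷ xs) f = cong (f (h x) +_) (∑ˡ-map h xs f)

∑ˡ-concatMap : ∀ {A B : Set} (h : A → List B) (xs : List A) f →
               ∑ˡ (List.concatMap h xs) f ≡ ∑ˡ xs (λ x → ∑ˡ (h x) f)
∑ˡ-concatMap h []       f = refl
∑ˡ-concatMap h (x ∷ xs) f =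
  trans (∑ˡ-++ (h x) (List.concatMap h xs) f) (cong (∑ˡ (h x) f +_) (∑ˡ-concatMap h xs f))

∑ˡ-tabulate : ∀ {B : Set} q (g : Fin q → B) f → ∑ˡ (List.tabulate g) f ≡ ∑ q (f ∘ g)
∑ˡ-tabulate zero    g f = refl
∑ˡ-tabulate (suc q) g f = cong (f (g zero) +_) (∑ˡ-tabulate q (g ∘ suc) f)

length-filter-∑ˡ : ∀ {A : Set} {P : A → Set} (P? : ∀ x → Dec (P x)) (xs : List A) →
                   length (filter P? xs) ≡ ∑ˡ xs (λ x → 𝟙 (does (P? x)))
length-filter-∑ˡ P? []       = refl
length-filter-∑ˡ P? (x ∷ xs) with does (P? x)
... | true  = cong suc (length-filter-∑ˡ P? xs)
... | false = length-filter-∑ˡ P? xs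

does-⇔ : ∀ {P Q : Set} → (P → Q) → (Q → P) → (p : Dec P) (q : Dec Q) → does p ≡ does q
does-⇔ f g (yes p) (yes q) = refl
does-⇔ f g (yes p) (no ¬q) = ⊥-elim (¬q (f p))
does-⇔ f g (no ¬p) (yes q) = ⊥-elim (¬p (g q))
does-⇔ f g (no ¬p) (no ¬q) = refl

𝟙-⇔ : ∀ {P Q : Set} → (P → Q) → (Q → P) → (p : Dec P) (q : Dec Q) → 𝟙 (does p) ≡ 𝟙 (does q)
𝟙-⇔ f g p q = cong 𝟙 (does-⇔ f g p q)

𝟙-× : ∀ {P Q R : Set} → (R → P × Q) → (P × Q → R) → (r : Dec R) (p : Dec P) (q : Dec Q) →
      𝟙 (does r) ≡ 𝟙 (does p) * 𝟙 (does q)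
𝟙-× f g r (yes p) (yes q) = 𝟙-⇔ f g r (yes (p , q))
𝟙-× f g r (yes p) (no ¬q) = 𝟙-⇔ f g r (no (¬q ∘ proj₂))
𝟙-× f g r (no ¬p) q       = 𝟙-⇔ f g r (no (¬p ∘ proj₁))

𝟙-¬ : ∀ {P : Set} (p : Dec P) → 𝟙 (does (¬? p)) + 𝟙 (does p) ≡ 1
𝟙-¬ (yes _) = refl
𝟙-¬ (no _)  = refl

𝟙-not : ∀ b → 𝟙 (not b) + 𝟙 b ≡ 1
𝟙-not true  = refl
𝟙-not false = refl

𝟙-^ : ∀ b m → 1 ≤ m → 𝟙 b ^ m ≡ 𝟙 b
𝟙-^ true  m       _ = ^-zeroˡ m
𝟙-^ false (suc m) _ = refl

does-yes : ∀ {P : Set} → P → (p : Dec P) → does p ≡ true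
does-yes x (yes _) = refl
does-yes x (no ¬x) = ⊥-elim (¬x x)

does-no : ∀ {P : Set} → ¬ P → (p : Dec P) → does p ≡ false
does-no ¬x (yes x) = ⊥-elim (¬x x)
does-no ¬x (no _)  = refl

∣∣-∑ : ∀ {n} (S : Vec Bool n) → ∣ S ∣ ≡ ∑ n (𝟙 ∘ lookup S)
∣∣-∑ []          = refl
∣∣-∑ (true ∷ S)  = cong suc (∣∣-∑ S)
∣∣-∑ (false ∷ S) = ∣∣-∑ S

DependsOn : ∀ {n q} {A : Set} → Vec Bool n → (Coloring n q → A) → Set
DependsOn S f = ∀ c c' → (∀ i → lookup S i ≡ true → c i ≡ c' i) → f c ≡ f c'

DependsOn-∘ : ∀ {n q} {A B : Set} {S : Vec Bool n} {f : Coloring n q → A} (h : A → B) →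
              DependsOn S f → DependsOn S (h ∘ f)
DependsOn-∘ h dep c c' agree = cong h (dep c c' agree)

-- Sums over all q-colourings, and partial sums over the colourings of a subset S
-- with every vertex outside S coloured by a fixed default colour d.
module ColouringSums (q : ℕ) (d : Fin q) where

  ∑ᶜ : ∀ n → (Coloring n q → ℕ) → ℕ
  ∑ᶜ n f = ∑ˡ (allColorings n q) f

  ∑ᶜ-cong : ∀ n {f g : Coloring n q → ℕ} → (∀ c → f c ≡ g c) → ∑ᶜ n f ≡ ∑ᶜ n g
  ∑ᶜ-cong n = ∑ˡ-cong (allColorings n q)

  ∑ᶜ-suc : ∀ n f → ∑ᶜ (suc n) f ≡ ∑ q (λ a → ∑ᶜ n (λ c → f (a ∷ᶠ c)))
  ∑ᶜ-suc n f =
    trans (∑ˡ-concatMap (λ a → map (a ∷ᶠ_) (allColorings n q)) (allFin q) f)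
      (trans (∑ˡ-tabulate q id _) (∑-cong q (λ a → ∑ˡ-map (a ∷ᶠ_) (allColorings n q) f)))

  -- The colouring of the empty vertex set, as listed by allColorings.
  ∅ᶜ : Coloring 0 q
  ∅ᶜ = List.foldr (λ c _ → c) (λ ()) (allColorings 0 q)

  ∑on : ∀ {n} → Vec Bool n → (Coloring n q → ℕ) → ℕ
  ∑on {zero} []          f = ∑ᶜ 0 f
  ∑on        (true ∷ S)  f = ∑ q (λ a → ∑on S (λ c → f (a ∷ᶠ c)))
  ∑on        (false ∷ S) f = ∑on S (λ c → f (d ∷ᶠ c))

  ∑on-cong : ∀ {n} (S : Vec Bool n) {f g : Coloring n q → ℕ} → (∀ c → f c ≡ g c) → ∑on S f ≡ ∑on S g
  ∑on-cong []          f≗g = ∑ᶜ-cong 0 f≗g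
  ∑on-cong (true ∷ S)  f≗g = ∑-cong q (λ a → ∑on-cong S (λ c → f≗g (a ∷ᶠ c)))
  ∑on-cong (false ∷ S) f≗g = ∑on-cong S (λ c → f≗g (d ∷ᶠ c))

  ∑on-+ : ∀ {n} (S : Vec Bool n) (f g : Coloring n q → ℕ) → ∑on S (λ c → f c + g c) ≡ ∑on S f + ∑on S g
  ∑on-+ []          f g = +-exchange (f ∅ᶜ) (g ∅ᶜ) 0 0
    where
    +-exchange : ∀ a b c d → a + b + (c + d) ≡ a + c + (b + d)
    +-exchange = solve-∀
  ∑on-+ (true ∷ S)  f g = trans (∑-cong q (λ a → ∑on-+ S _ _)) (∑-+ q _ _)
  ∑on-+ (false ∷ S) f g = ∑on-+ S _ _

  ∑on-*ˡ : ∀ {n} (S : Vec Bool n) x (f : Coloring n q → ℕ) → ∑on S (λ c → x * f c) ≡ x * ∑on S f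
  ∑on-*ˡ []          x f = trans (+-identityʳ _) (cong (x *_) (sym (+-identityʳ _)))
  ∑on-*ˡ (true ∷ S)  x f = trans (∑-cong q (λ a → ∑on-*ˡ S x _)) (∑-*ˡ q _ x)
  ∑on-*ˡ (false ∷ S) x f = ∑on-*ˡ S x _

  ∑on-1 : ∀ {n} (S : Vec Bool n) → ∑on S (λ _ → 1) ≡ q ^ ∣ S ∣
  ∑on-1 []          = refl
  ∑on-1 (true ∷ S)  = trans (∑-cong q (λ _ → ∑on-1 S)) (∑-const q _)
  ∑on-1 (false ∷ S) = ∑on-1 S

  ∑ᶜ-∑on : ∀ n f → ∑ᶜ n f ≡ ∑on (replicate n true) f
  ∑ᶜ-∑on zero    f = refl
  ∑ᶜ-∑on (suc n) f = trans (∑ᶜ-suc n f) (∑-cong q (λ a → ∑ᶜ-∑on n _))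

  peel : Bool → (Fin q → ℕ) → ℕ
  peel true  y = ∑ q y
  peel false y = y d

  restrict : ∀ {n} {A : Set} b (S : Vec Bool n) (f : Coloring (suc n) q → A) a →
             DependsOn (b ∷ S) f → DependsOn S (λ c → f (a ∷ᶠ c))
  restrict b S f a dep c c' agree = dep (a ∷ᶠ c) (a ∷ᶠ c') λ { zero _ → refl ; (suc i) p → agree i p }

  ignore : ∀ {n} {A : Set} (S : Vec Bool n) (f : Coloring (suc n) q → A) a c →
           DependsOn (false ∷ S) f → f (a ∷ᶠ c) ≡ f (d ∷ᶠ c)
  ignore S f a c dep = dep _ _ λ { zero () ; (suc i) _ → refl }

  ∑on-* : ∀ {n} (S₁ S₂ T : Vec Bool n) f₁ f₂ → DependsOn S₁ f₁ → DependsOn S₂ f₂ →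
          (∀ i → lookup T i ≡ (lookup S₁ i ∨ lookup S₂ i)) → (∀ i → (lookup S₁ i ∧ lookup S₂ i) ≡ false) →
          ∑on T (λ c → f₁ c * f₂ c) ≡ ∑on S₁ f₁ * ∑on S₂ f₂
  ∑on-* [] [] [] f₁ f₂ _ _ _ _ =
    trans (+-identityʳ _) (sym (cong₂ _*_ (+-identityʳ (f₁ ∅ᶜ)) (+-identityʳ (f₂ ∅ᶜ))))
  ∑on-* (x ∷ S₁) (y ∷ S₂) (z ∷ T) f₁ f₂ dep₁ dep₂ union disjoint =
    step x y z (union zero) (disjoint zero) f₁ f₂ dep₁ dep₂
    where
    union' : ∀ i → lookup T i ≡ (lookup S₁ i ∨ lookup S₂ i)
    union' = union ∘ suc
    disjoint' : ∀ i → (lookup S₁ i ∧ lookup S₂ i) ≡ false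
    disjoint' = disjoint ∘ suc
    step : ∀ x y z → z ≡ (x ∨ y) → (x ∧ y) ≡ false → ∀ f₁ f₂ →
           DependsOn (x ∷ S₁) f₁ → DependsOn (y ∷ S₂) f₂ →
           ∑on (z ∷ T) (λ c → f₁ c * f₂ c) ≡ ∑on (x ∷ S₁) f₁ * ∑on (y ∷ S₂) f₂
    step true true _ _ () _ _ _ _
    step true false true _ _ f₁ f₂ dep₁ dep₂ =
      trans (∑-cong q (λ a →
              trans (∑on-* S₁ S₂ T _ _ (restrict true S₁ f₁ a dep₁) (restrict false S₂ f₂ a dep₂) union' disjoint')
                    (cong (∑on S₁ (λ c → f₁ (a ∷ᶠ c)) *_) (∑on-cong S₂ (λ c → ignore S₂ f₂ a c dep₂)))))
            (∑-*ʳ q _ _)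
    step false true true _ _ f₁ f₂ dep₁ dep₂ =
      trans (∑-cong q (λ a →
              trans (∑on-* S₁ S₂ T _ _ (restrict false S₁ f₁ a dep₁) (restrict true S₂ f₂ a dep₂) union' disjoint')
                    (cong (_* ∑on S₂ (λ c → f₂ (a ∷ᶠ c))) (∑on-cong S₁ (λ c → ignore S₁ f₁ a c dep₁)))))
            (∑-*ˡ q (λ a → ∑on S₂ (λ c → f₂ (a ∷ᶠ c))) (∑on S₁ (λ c → f₁ (d ∷ᶠ c))))
    step false false false _ _ f₁ f₂ dep₁ dep₂ =
      ∑on-* S₁ S₂ T _ _ (restrict false S₁ f₁ d dep₁) (restrict false S₂ f₂ d dep₂) union' disjoint'
    step true  false false () _ _ _ _ _
    step false true  false () _ _ _ _ _
    step false false true  () _ _ _ _ _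

product-𝟙≤1 : ∀ {A : Set} (f : A → Bool) xs → product (map (𝟙 ∘ f) xs) ≤ 1
product-𝟙≤1 f []       = ≤-refl
product-𝟙≤1 f (x ∷ xs) with f x
... | true  = subst (_≤ 1) (sym (+-identityʳ _)) (product-𝟙≤1 f xs)
... | false = z≤n

≤1⇒^≡ : ∀ x k → 1 ≤ k → x ≤ 1 → x ^ k ≡ x
≤1⇒^≡ zero    (suc k) _ _         = refl
≤1⇒^≡ (suc zero) k    _ _         = ^-zeroˡ k
≤1⇒^≡ (suc (suc x)) k _ (s≤s ())

-- The proof is by induction on the number of vertices: summing out the colour of
-- vertex 0 is an instance of Hölder's inequality in which the tests not involving
-- vertex 0 contribute constant factors.
module Finner (q : ℕ) (d : Fin q) (k : ℕ) (k≥1 : 1 ≤ k) where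
  open ColouringSums q d

  -- The slice of a test at vertex 0: whether vertex 0 is in its support, and the
  -- count of the remaining coordinates as a function of the colour of vertex 0.
  Slice : Set
  Slice = Bool × (Fin q → ℕ)

  ConstantIfOff : Slice → Set
  ConstantIfOff (b , y) = b ≡ false → ∀ a → y a ≡ y d

  active : List Slice → List (Fin q → ℕ)
  active []               = []
  active ((true , y) ∷ ss)  = y ∷ active ss
  active ((false , y) ∷ ss) = active ss

  inactiveFactor : List Slice → ℕ
  inactiveFactor []               = 1
  inactiveFactor ((true , y) ∷ ss)  = inactiveFactor ss
  inactiveFactor ((false , y) ∷ ss) = y d * inactiveFactor ss

  length-active : ∀ ss → length (active ss) ≡ sum (map (𝟙 ∘ proj₁) ss)
  length-active []               = refl
  length-active ((true , y) ∷ ss)  = cong suc (length-active ss)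
  length-active ((false , y) ∷ ss) = length-active ss

  product-slices : ∀ ss → All ConstantIfOff ss → ∀ a →
    product (map (λ s → proj₂ s a) ss) ≡ inactiveFactor ss * product (map (λ y → y a) (active ss))
  product-slices []                 []         a = refl
  product-slices ((true , y) ∷ ss)  (_ ∷ cs)   a rewrite product-slices ss cs a =
    x*[y*z]≡y*[x*z] (y a) (inactiveFactor ss) _
    where
    x*[y*z]≡y*[x*z] : ∀ x y z → x * (y * z) ≡ y * (x * z)
    x*[y*z]≡y*[x*z] = solve-∀
  product-slices ((false , y) ∷ ss) (c ∷ cs)   a rewrite product-slices ss cs a | c refl a =
    sym (*-assoc (y d) (inactiveFactor ss) _)

  peel-slice : Slice → ℕ
  peel-slice (b , y) = peel b y

  product-peel : ∀ ss → product (map peel-slice ss) ≡ inactiveFactor ss * product (map (∑ q) (active ss))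
  product-peel []                 = refl
  product-peel ((true , y) ∷ ss)  rewrite product-peel ss =
    x*[y*z]≡y*[x*z] (∑ q y) (inactiveFactor ss) _
    where
    x*[y*z]≡y*[x*z] : ∀ x y z → x * (y * z) ≡ y * (x * z)
    x*[y*z]≡y*[x*z] = solve-∀
  product-peel ((false , y) ∷ ss) rewrite product-peel ss = sym (*-assoc (y d) (inactiveFactor ss) _)

  holder-slices : ∀ ss (u : Fin q → ℕ) → sum (map (𝟙 ∘ proj₁) ss) ≡ k → All ConstantIfOff ss →
    (∀ a → u a ^ k ≤ product (map (λ s → proj₂ s a) ss)) → ∑ q u ^ k ≤ product (map peel-slice ss)
  holder-slices ss u #active constant bound = subst (∑ q u ^ k ≤_) (sym (product-peel ss))
    (holder q k (active ss) u (inactiveFactor ss) (trans (length-active ss) #active) k≥1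
      (λ a → subst (u a ^ k ≤_) (product-slices ss constant a) (bound a)))

  record LocalTest (n : ℕ) : Set where
    constructor test
    field
      support : Vec Bool n
      holds   : Coloring n q → Bool
      local   : DependsOn support holds
  open LocalTest

  passesAll : ∀ {n} → List (LocalTest n) → Coloring n q → ℕ
  passesAll ts c = product (map (λ t → 𝟙 (holds t c)) ts)

  coverage : ∀ {n} → List (LocalTest n) → Fin n → ℕ
  coverage ts i = sum (map (λ t → 𝟙 (lookup (support t) i)) ts)

  finnerBound : ∀ {n} → List (LocalTest n) → ℕ
  finnerBound ts = product (map (λ t → ∑on (support t) (𝟙 ∘ holds t)) ts)

  restrictTest : ∀ {n} → Fin q → LocalTest (suc n) → LocalTest n
  restrictTest a (test (b ∷ S) g local) = test S (λ c → g (a ∷ᶠ c)) (restrict b S g a local)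

  slice : ∀ {n} → LocalTest (suc n) → Slice
  slice (test (b ∷ S) g _) = b , λ a → ∑on S (λ c → 𝟙 (g (a ∷ᶠ c)))

  passesAll-restrict : ∀ {n} (ts : List (LocalTest (suc n))) a c →
                       passesAll ts (a ∷ᶠ c) ≡ passesAll (map (restrictTest a) ts) c
  passesAll-restrict []                        a c = refl
  passesAll-restrict (test (b ∷ S) g _ ∷ ts) a c = cong (𝟙 (g (a ∷ᶠ c)) *_) (passesAll-restrict ts a c)

  coverage-restrict : ∀ {n} (ts : List (LocalTest (suc n))) a i →
                      coverage (map (restrictTest a) ts) i ≡ coverage ts (suc i)
  coverage-restrict []                        a i = refl
  coverage-restrict (test (b ∷ S) g _ ∷ ts) a i = cong (𝟙 (lookup S i) +_) (coverage-restrict ts a i)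

  coverage-zero : ∀ {n} (ts : List (LocalTest (suc n))) →
                  coverage ts zero ≡ sum (map (𝟙 ∘ proj₁) (map slice ts))
  coverage-zero []                        = refl
  coverage-zero (test (b ∷ S) g _ ∷ ts) = cong (𝟙 b +_) (coverage-zero ts)

  finnerBound-restrict : ∀ {n} (ts : List (LocalTest (suc n))) a →
    finnerBound (map (restrictTest a) ts) ≡ product (map (λ s → proj₂ s a) (map slice ts))
  finnerBound-restrict []                        a = refl
  finnerBound-restrict (test (b ∷ S) g _ ∷ ts) a =
    cong (∑on S (λ c → 𝟙 (g (a ∷ᶠ c))) *_) (finnerBound-restrict ts a)

  finnerBound-peel : ∀ {n} (ts : List (LocalTest (suc n))) →
                     product (map peel-slice (map slice ts)) ≡ finnerBound ts
  finnerBound-peel []                            = refl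
  finnerBound-peel (test (true ∷ S) g _ ∷ ts)  =
    cong (∑ q (λ a → ∑on S (λ c → 𝟙 (g (a ∷ᶠ c)))) *_) (finnerBound-peel ts)
  finnerBound-peel (test (false ∷ S) g _ ∷ ts) =
    cong (∑on S (λ c → 𝟙 (g (d ∷ᶠ c))) *_) (finnerBound-peel ts)

  slices-constant : ∀ {n} (ts : List (LocalTest (suc n))) → All ConstantIfOff (map slice ts)
  slices-constant []                            = []
  slices-constant (test (b ∷ S) g local ∷ ts) = constant ∷ slices-constant ts
    where
    constant : ConstantIfOff (slice (test (b ∷ S) g local))
    constant refl a = ∑on-cong S (λ c → cong 𝟙 (ignore S g a c local))

  finnerBound-empty : ∀ (ts : List (LocalTest 0)) → finnerBound ts ≡ passesAll ts ∅ᶜ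
  finnerBound-empty []                   = refl
  finnerBound-empty (test [] g _ ∷ ts) = cong₂ _*_ (+-identityʳ (𝟙 (g ∅ᶜ))) (finnerBound-empty ts)

  finner : ∀ n (ts : List (LocalTest n)) → (∀ i → coverage ts i ≡ k) →
           ∑ᶜ n (passesAll ts) ^ k ≤ finnerBound ts
  finner zero    ts _ rewrite +-identityʳ (passesAll ts ∅ᶜ) | finnerBound-empty ts =
    ≤-reflexive (≤1⇒^≡ (passesAll ts ∅ᶜ) k k≥1 (product-𝟙≤1 (λ t → holds t ∅ᶜ) ts))
  finner (suc n) ts covered = begin
    ∑ᶜ (suc n) (passesAll ts) ^ k                    ≡⟨ cong (_^ k) sum-by-colour-of-0 ⟩
    ∑ q u ^ k                                        ≤⟨ holder-slices (map slice ts) u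
                                                          (trans (sym (coverage-zero ts)) (covered zero))
                                                          (slices-constant ts) restricted ⟩
    product (map peel-slice (map slice ts))          ≡⟨ finnerBound-peel ts ⟩
    finnerBound ts                                   ∎
    where
    open ≤-Reasoning
    u : Fin q → ℕ
    u a = ∑ᶜ n (passesAll (map (restrictTest a) ts))
    sum-by-colour-of-0 : ∑ᶜ (suc n) (passesAll ts) ≡ ∑ q u
    sum-by-colour-of-0 = trans (∑ᶜ-suc n (passesAll ts)) (∑-cong q (λ a → ∑ᶜ-cong n (passesAll-restrict ts a)))
    restricted : ∀ a → u a ^ k ≤ product (map (λ s → proj₂ s a) (map slice ts))
    restricted a = subst (u a ^ k ≤_) (finnerBound-restrict ts a)
      (finner n (map (restrictTest a) ts) (λ i → trans (coverage-restrict ts a i) (covered (suc i))))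

lookup-ext : ∀ {n} {A : Set} {xs ys : Vec A n} → (∀ i → lookup xs i ≡ lookup ys i) → xs ≡ ys
lookup-ext {xs = xs} {ys} same =
  trans (sym (Vecₚ.tabulate∘lookup xs)) (trans (Vecₚ.tabulate-cong same) (Vecₚ.tabulate∘lookup ys))

∑-not : ∀ n (S : Vec Bool n) → ∑ n (𝟙 ∘ not ∘ lookup S) ≡ n ∸ ∣ S ∣
∑-not n S = sym (begin
  n ∸ ∣ S ∣                                                ≡⟨ cong₂ _∸_ (sym partition) (∣∣-∑ S) ⟩
  ∑ n (𝟙 ∘ not ∘ lookup S) + ∑ n (𝟙 ∘ lookup S) ∸ ∑ n (𝟙 ∘ lookup S) ≡⟨ m+n∸n≡m _ (∑ n (𝟙 ∘ lookup S)) ⟩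
  ∑ n (𝟙 ∘ not ∘ lookup S)                                 ∎)
  where
  open ≡-Reasoning
  partition : ∑ n (𝟙 ∘ not ∘ lookup S) + ∑ n (𝟙 ∘ lookup S) ≡ n
  partition = trans (sym (∑-+ n _ _))
    (trans (∑-cong n (λ i → 𝟙-not (lookup S i))) (trans (∑-const n 1) (*-identityʳ n)))

∣[]≔true∣ : ∀ {n} (S : Vec Bool n) i → lookup S i ≡ false → ∣ S [ i ]≔ true ∣ ≡ suc ∣ S ∣
∣[]≔true∣ (false ∷ S) zero    _   = refl
∣[]≔true∣ (true ∷ S)  (suc i) i∉S = cong suc (∣[]≔true∣ S i i∉S)
∣[]≔true∣ (false ∷ S) (suc i) i∉S = ∣[]≔true∣ S i i∉S

fall-suc : ∀ x m → fall x (suc m) ≡ x * fall (x ∸ 1) m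
fall-suc x zero    = trans (*-identityˡ x) (sym (*-identityʳ x))
fall-suc x (suc m) rewrite fall-suc x m =
  trans (*-assoc x (fall (x ∸ 1) m) (x ∸ suc m))
        (cong (λ z → x * (fall (x ∸ 1) m * z)) (sym (∸-+-assoc x 1 m)))

∑-≟ : ∀ q (a : Fin q) → ∑ q (λ b → 𝟙 (does (b Fin.≟ a))) ≡ 1
∑-≟ (suc q) zero    = cong suc (∑-zero q _ (λ _ → refl))
∑-≟ (suc q) (suc a) =
  trans (∑-cong q (λ b → 𝟙-⇔ Finₚ.suc-injective (cong suc) (suc b Fin.≟ suc a) (b Fin.≟ a))) (∑-≟ q a)

∈⇒lookup : ∀ {n} {S : Subset n} {i} → i ∈ S → lookup S i ≡ true
∈⇒lookup = Vecₚ.[]=⇒lookup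

lookup⇒∈ : ∀ {n} {S : Subset n} {i} → lookup S i ≡ true → i ∈ S
lookup⇒∈ {S = S} {i} = Vecₚ.lookup⇒[]= i S

properOn : ∀ {n q} → Subset n → Coloring n q → Bool
properOn e c = does (¬? (mono? c e))

rainbowOn : ∀ {n q} → Subset n → Coloring n q → Bool
rainbowOn e c = does (rainbowEdge? c e)

mono-local : ∀ {n q} (e : Subset n) (c c' : Coloring n q) →
             (∀ i → lookup e i ≡ true → c i ≡ c' i) → Monochromatic c e → Monochromatic c' e
mono-local e c c' agree mono u w u∈e w∈e =
  trans (sym (agree u (∈⇒lookup u∈e))) (trans (mono u w u∈e w∈e) (agree w (∈⇒lookup w∈e)))

rainbow-local : ∀ {n q} (e : Subset n) (c c' : Coloring n q) →
                (∀ i → lookup e i ≡ true → c i ≡ c' i) → RainbowEdge c e → RainbowEdge c' e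
rainbow-local e c c' agree rainbow u w u∈e w∈e u≢w cu≡cw = rainbow u w u∈e w∈e u≢w
  (trans (agree u (∈⇒lookup u∈e)) (trans cu≡cw (sym (agree w (∈⇒lookup w∈e)))))

properOn-local : ∀ {n q} (e : Subset n) → DependsOn {q = q} e (properOn e)
properOn-local e c c' agree = does-⇔
  (λ ¬mono mono → ¬mono (mono-local e c' c (λ i p → sym (agree i p)) mono))
  (λ ¬mono mono → ¬mono (mono-local e c c' agree mono)) (¬? (mono? c e)) (¬? (mono? c' e))

rainbowOn-local : ∀ {n q} (e : Subset n) → DependsOn {q = q} e (rainbowOn e)
rainbowOn-local e c c' agree = does-⇔ (rainbow-local e c c' agree)
  (rainbow-local e c' c (λ i p → sym (agree i p))) (rainbowEdge? c e) (rainbowEdge? c' e)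

module EdgeCounts (q : ℕ) (d : Fin q) where
  open ColouringSums q d

  Constant : ∀ {n} → Vec Bool n → Coloring n q → Fin q → Set
  Constant S c a = ∀ i → lookup S i ≡ true → c i ≡ a

  constant? : ∀ {n} (S : Vec Bool n) c a → Dec (Constant S c a)
  constant? S c a = Finₚ.all? λ i → (lookup S i Boolₚ.≟ true) →-dec (c i Fin.≟ a)

  ∑on-constant : ∀ {n} (S : Vec Bool n) a → ∑on S (λ c → 𝟙 (does (constant? S c a))) ≡ 1
  ∑on-constant []          a = cong (λ z → 𝟙 z + 0) (does-yes (λ ()) (constant? [] ∅ᶜ a))
  ∑on-constant (true ∷ S)  a = begin
    ∑ q (λ b → ∑on S (λ c → 𝟙 (does (constant? (true ∷ S) (b ∷ᶠ c) a))))
      ≡⟨ ∑-cong q (λ b → ∑on-cong S (λ c → 𝟙-× (split b c) (join b c)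
           (constant? (true ∷ S) (b ∷ᶠ c) a) (b Fin.≟ a) (constant? S c a))) ⟩
    ∑ q (λ b → ∑on S (λ c → 𝟙 (does (b Fin.≟ a)) * 𝟙 (does (constant? S c a))))
      ≡⟨ ∑-cong q (λ b → trans (∑on-*ˡ S (𝟙 (does (b Fin.≟ a))) (λ c → 𝟙 (does (constant? S c a))))
                               (cong (𝟙 (does (b Fin.≟ a)) *_) (∑on-constant S a))) ⟩
    ∑ q (λ b → 𝟙 (does (b Fin.≟ a)) * 1)
      ≡⟨ trans (∑-cong q (λ b → *-identityʳ _)) (∑-≟ q a) ⟩
    1 ∎
    where
    open ≡-Reasoning
    split : ∀ b c → Constant (true ∷ S) (b ∷ᶠ c) a → (b ≡ a) × Constant S c a
    split b c const = const zero refl , λ i → const (suc i)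
    join : ∀ b c → (b ≡ a) × Constant S c a → Constant (true ∷ S) (b ∷ᶠ c) a
    join b c (b≡a , _)     zero    _ = b≡a
    join b c (_   , const) (suc i) p = const i p
  ∑on-constant (false ∷ S) a = trans
    (∑on-cong S (λ c → 𝟙-⇔ (λ const i → const (suc i)) (λ { const zero () ; const (suc i) p → const i p })
      (constant? (false ∷ S) (d ∷ᶠ c) a) (constant? S c a)))
    (∑on-constant S a)

  -- A colouring of a nonempty edge is monochromatic iff it is constantly the colour of
  -- its first vertex, so there are exactly q monochromatic colourings.
  ∑on-mono : ∀ {n} (S : Vec Bool n) → 1 ≤ ∣ S ∣ → ∑on S (λ c → 𝟙 (does (mono? c S))) ≡ q
  ∑on-mono (true ∷ S)  _ =
    trans (∑-cong q (λ b → trans (∑on-cong S (λ c →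
            𝟙-⇔ (to b c) (from b c) (mono? (b ∷ᶠ c) (true ∷ S)) (constant? S c b))) (∑on-constant S b)))
          (trans (∑-const q 1) (*-identityʳ q))
    where
    to : ∀ b c → Monochromatic (b ∷ᶠ c) (true ∷ S) → Constant S c b
    to b c mono i p = sym (mono zero (suc i) (lookup⇒∈ refl) (lookup⇒∈ p))
    from : ∀ b c → Constant S c b → Monochromatic (b ∷ᶠ c) (true ∷ S)
    from b c const u w u∈ w∈ = colour u (∈⇒lookup u∈) (∈⇒lookup w∈)
      where
      colour : ∀ u → lookup (true ∷ S) u ≡ true → lookup (true ∷ S) w ≡ true → (b ∷ᶠ c) u ≡ (b ∷ᶠ c) w
      colour u pu pw = trans (is-b u pu) (sym (is-b w pw))
        where
        is-b : ∀ v → lookup (true ∷ S) v ≡ true → (b ∷ᶠ c) v ≡ b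
        is-b zero    _ = refl
        is-b (suc v) p = const v p
  ∑on-mono (false ∷ S) s =
    trans (∑on-cong S (λ c → 𝟙-⇔ (to c) (from c) (mono? (d ∷ᶠ c) (false ∷ S)) (mono? c S))) (∑on-mono S s)
    where
    to : ∀ c → Monochromatic (d ∷ᶠ c) (false ∷ S) → Monochromatic c S
    to c mono u w u∈ w∈ = mono (suc u) (suc w) (there u∈) (there w∈)
    from : ∀ c → Monochromatic c S → Monochromatic (d ∷ᶠ c) (false ∷ S)
    from c mono (suc u) (suc w) (there u∈) (there w∈) = mono u w u∈ w∈

  ∑on-properOn : ∀ {n} (S : Vec Bool n) → 1 ≤ ∣ S ∣ → ∑on S (𝟙 ∘ properOn S) ≡ q ^ ∣ S ∣ ∸ q
  ∑on-properOn S nonempty = trans (sym (m+n∸n≡m _ q)) (cong (_∸ q) (begin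
    ∑on S (𝟙 ∘ properOn S) + q
      ≡⟨ cong (∑on S (𝟙 ∘ properOn S) +_) (∑on-mono S nonempty) ⟨
    ∑on S (𝟙 ∘ properOn S) + ∑on S (λ c → 𝟙 (does (mono? c S)))
      ≡⟨ ∑on-+ S _ _ ⟨
    ∑on S (λ c → 𝟙 (properOn S c) + 𝟙 (does (mono? c S)))
      ≡⟨ ∑on-cong S (λ c → 𝟙-¬ (mono? c S)) ⟩
    ∑on S (λ _ → 1)
      ≡⟨ ∑on-1 S ⟩
    q ^ ∣ S ∣ ∎))
    where open ≡-Reasoning

  RainbowAvoiding : ∀ {n} → Vec Bool n → Vec Bool q → Coloring n q → Set
  RainbowAvoiding S A c = (∀ u w → lookup S u ≡ true → lookup S w ≡ true → ¬ u ≡ w → ¬ c u ≡ c w)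
                        × (∀ i → lookup S i ≡ true → lookup A (c i) ≡ false)

  rainbowAvoiding? : ∀ {n} (S : Vec Bool n) A c → Dec (RainbowAvoiding S A c)
  rainbowAvoiding? S A c =
    (Finₚ.all? λ u → Finₚ.all? λ w → (lookup S u Boolₚ.≟ true) →-dec ((lookup S w Boolₚ.≟ true) →-dec
      (¬? (u Fin.≟ w) →-dec ¬? (c u Fin.≟ c w))))
    ×-dec (Finₚ.all? λ i → (lookup S i Boolₚ.≟ true) →-dec (lookup A (c i) Boolₚ.≟ false))

  unreserved⇒ : ∀ (A : Vec Bool q) b j → lookup (A [ b ]≔ true) j ≡ false → ¬ j ≡ b × lookup A j ≡ false
  unreserved⇒ A b j free with b Fin.≟ j
  ... | no b≢j   = (λ j≡b → b≢j (sym j≡b)) , trans (sym (Vecₚ.lookup∘update′ (λ j≡b → b≢j (sym j≡b)) A true)) free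
  ... | yes refl with trans (sym (Vecₚ.lookup∘update b A true)) free
  ...   | ()

  rainbowAvoiding-in : ∀ {n} (S : Vec Bool n) A b c →
    RainbowAvoiding (true ∷ S) A (b ∷ᶠ c) → lookup A b ≡ false × RainbowAvoiding S (A [ b ]≔ true) c
  rainbowAvoiding-in S A b c (rainbow , avoids) = avoids zero refl ,
    (λ u w pu pw u≢w → rainbow (suc u) (suc w) pu pw (u≢w ∘ Finₚ.suc-injective)) ,
    (λ i p → trans (Vecₚ.lookup∘update′ (rainbow (suc i) zero p refl λ ()) A true) (avoids (suc i) p))

  rainbowAvoiding-in⁻ : ∀ {n} (S : Vec Bool n) A b c →
    lookup A b ≡ false × RainbowAvoiding S (A [ b ]≔ true) c → RainbowAvoiding (true ∷ S) A (b ∷ᶠ c)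
  rainbowAvoiding-in⁻ S A b c (b-free , (rainbow , avoids)) = rainbow′ , avoids′
    where
    rainbow′ : ∀ u w → lookup (true ∷ S) u ≡ true → lookup (true ∷ S) w ≡ true → ¬ u ≡ w →
               ¬ (b ∷ᶠ c) u ≡ (b ∷ᶠ c) w
    rainbow′ zero    zero    _  _  u≢w _ = u≢w refl
    rainbow′ zero    (suc w) _  pw _   e = proj₁ (unreserved⇒ A b (c w) (avoids w pw)) (sym e)
    rainbow′ (suc u) zero    pu _  _   e = proj₁ (unreserved⇒ A b (c u) (avoids u pu)) e
    rainbow′ (suc u) (suc w) pu pw u≢w   = rainbow u w pu pw (u≢w ∘ cong suc)
    avoids′ : ∀ i → lookup (true ∷ S) i ≡ true → lookup A ((b ∷ᶠ c) i) ≡ false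
    avoids′ zero    _ = b-free
    avoids′ (suc i) p = proj₂ (unreserved⇒ A b (c i) (avoids i p))

  rainbowAvoiding-out : ∀ {n} (S : Vec Bool n) A c → RainbowAvoiding (false ∷ S) A (d ∷ᶠ c) → RainbowAvoiding S A c
  rainbowAvoiding-out S A c (rainbow , avoids) =
    (λ u w pu pw u≢w → rainbow (suc u) (suc w) pu pw (u≢w ∘ Finₚ.suc-injective)) , avoids ∘ suc

  rainbowAvoiding-out⁻ : ∀ {n} (S : Vec Bool n) A c → RainbowAvoiding S A c → RainbowAvoiding (false ∷ S) A (d ∷ᶠ c)
  rainbowAvoiding-out⁻ S A c (rainbow , avoids) = rainbow′ , avoids′
    where
    rainbow′ : ∀ u w → lookup (false ∷ S) u ≡ true → lookup (false ∷ S) w ≡ true → ¬ u ≡ w →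
               ¬ (d ∷ᶠ c) u ≡ (d ∷ᶠ c) w
    rainbow′ (suc u) (suc w) pu pw u≢w = rainbow u w pu pw (u≢w ∘ cong suc)
    avoids′ : ∀ i → lookup (false ∷ S) i ≡ true → lookup A ((d ∷ᶠ c) i) ≡ false
    avoids′ (suc i) p = avoids i p

  -- Colouring the vertices of S one by one with distinct colours outside A:
  -- there are (q - |A|)(q - |A| - 1) ⋯ choices.
  ∑on-rainbowAvoiding : ∀ {n} (S : Vec Bool n) A →
    ∑on S (λ c → 𝟙 (does (rainbowAvoiding? S A c))) ≡ fall (q ∸ ∣ A ∣) ∣ S ∣
  ∑on-rainbowAvoiding []          A = cong (λ z → 𝟙 z + 0) (does-yes ((λ ()) , (λ ())) (rainbowAvoiding? [] A ∅ᶜ))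
  ∑on-rainbowAvoiding (true ∷ S)  A = begin
    ∑ q (λ b → ∑on S (λ c → 𝟙 (does (rainbowAvoiding? (true ∷ S) A (b ∷ᶠ c)))))
      ≡⟨ ∑-cong q (λ b → ∑on-cong S (λ c → 𝟙-× (rainbowAvoiding-in S A b c) (rainbowAvoiding-in⁻ S A b c)
           (rainbowAvoiding? (true ∷ S) A (b ∷ᶠ c)) (lookup A b Boolₚ.≟ false) (rainbowAvoiding? S (A [ b ]≔ true) c))) ⟩
    ∑ q (λ b → ∑on S (λ c → 𝟙 (does (lookup A b Boolₚ.≟ false)) * 𝟙 (does (rainbowAvoiding? S (A [ b ]≔ true) c))))
      ≡⟨ ∑-cong q (λ b → trans (∑on-*ˡ S (𝟙 (does (lookup A b Boolₚ.≟ false))) (λ c → 𝟙 (does (rainbowAvoiding? S (A [ b ]≔ true) c)))) (choose b)) ⟩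
    ∑ q (λ b → 𝟙 (not (lookup A b)) * F)
      ≡⟨ ∑-*ʳ q (𝟙 ∘ not ∘ lookup A) F ⟩
    ∑ q (𝟙 ∘ not ∘ lookup A) * F
      ≡⟨ cong (_* F) (∑-not q A) ⟩
    (q ∸ ∣ A ∣) * F
      ≡⟨ cong (λ z → (q ∸ ∣ A ∣) * fall z ∣ S ∣) (∸-+-assoc q ∣ A ∣ 1) ⟨
    (q ∸ ∣ A ∣) * fall (q ∸ ∣ A ∣ ∸ 1) ∣ S ∣
      ≡⟨ fall-suc (q ∸ ∣ A ∣) ∣ S ∣ ⟨
    fall (q ∸ ∣ A ∣) (suc ∣ S ∣) ∎
    where
    open ≡-Reasoning
    F : ℕ
    F = fall (q ∸ (∣ A ∣ + 1)) ∣ S ∣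
    choose : ∀ b → 𝟙 (does (lookup A b Boolₚ.≟ false)) * ∑on S (λ c → 𝟙 (does (rainbowAvoiding? S (A [ b ]≔ true) c)))
                   ≡ 𝟙 (not (lookup A b)) * F
    choose b with lookup A b in b-free
    ... | true  = refl
    ... | false = cong (1 *_) (trans (∑on-rainbowAvoiding S (A [ b ]≔ true))
                    (cong (λ z → fall (q ∸ z) ∣ S ∣) (trans (∣[]≔true∣ A b b-free) (+-comm 1 ∣ A ∣))))
  ∑on-rainbowAvoiding (false ∷ S) A =
    trans (∑on-cong S (λ c → 𝟙-⇔ (rainbowAvoiding-out S A c) (rainbowAvoiding-out⁻ S A c)
            (rainbowAvoiding? (false ∷ S) A (d ∷ᶠ c)) (rainbowAvoiding? S A c)))
          (∑on-rainbowAvoiding S A)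

  ∑on-rainbowOn : ∀ {n} (S : Vec Bool n) → ∑on S (𝟙 ∘ rainbowOn S) ≡ fall q ∣ S ∣
  ∑on-rainbowOn S =
    trans (∑on-cong S (λ c → 𝟙-⇔ (to c) (from c) (rainbowEdge? c S) (rainbowAvoiding? S none c)))
      (trans (∑on-rainbowAvoiding S none) (cong (λ z → fall (q ∸ z) ∣ S ∣) (Subsetₚ.∣⊥∣≡0 q)))
    where
    none : Vec Bool q
    none = replicate q false
    to : ∀ c → RainbowEdge c S → RainbowAvoiding S none c
    to c rainbow = (λ u w pu pw → rainbow u w (lookup⇒∈ pu) (lookup⇒∈ pw)) , (λ i _ → Vecₚ.lookup-replicate (c i) false)
    from : ∀ c → RainbowAvoiding S none c → RainbowEdge c S
    from c (rainbow , _) u w u∈ w∈ = rainbow u w (∈⇒lookup u∈) (∈⇒lookup w∈)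

sum-map-tabulate : ∀ {A : Set} n (g : Fin n → A) (f : A → ℕ) → sum (map f (List.tabulate g)) ≡ ∑ n (f ∘ g)
sum-map-tabulate zero    g f = refl
sum-map-tabulate (suc n) g f = cong (f (g zero) +_) (sum-map-tabulate n (g ∘ suc) f)

product-map-tabulate : ∀ {A : Set} n (g : Fin n → A) (f : A → ℕ) X → (∀ v → f (g v) ≡ X) →
                       product (map f (List.tabulate g)) ≡ X ^ n
product-map-tabulate zero    g f X _     = refl
product-map-tabulate (suc n) g f X f≡X = cong₂ _*_ (f≡X zero) (product-map-tabulate n (g ∘ suc) f X (f≡X ∘ suc))

𝟙-All : ∀ {A : Set} {P : A → Set} (P? : ∀ x → Dec (P x)) xs →
        𝟙 (does (All.all? P? xs)) ≡ product (map (λ x → 𝟙 (does (P? x))) xs)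
𝟙-All P? []       = refl
𝟙-All P? (x ∷ xs) = trans (𝟙-× (λ { (p ∷ ps) → p , ps }) (λ (p , ps) → p ∷ ps) (All.all? P? (x ∷ xs)) (P? x) (All.all? P? xs))
                          (cong (𝟙 (does (P? x)) *_) (𝟙-All P? xs))

symmetric-coverage : ∀ {n} (E : Fin n → Subset n) → (∀ v i → lookup (E v) i ≡ lookup (E i) v) →
                     ∀ i → ∑ n (λ v → 𝟙 (lookup (E v) i)) ≡ ∣ E i ∣
symmetric-coverage {n} E symmetric i = trans (∑-cong n (λ v → cong 𝟙 (symmetric v i))) (sym (∣∣-∑ (E i)))

module HypergraphCounts (q : ℕ) (d : Fin q) where
  open ColouringSums q d

  count-All : ∀ {n} {P : Coloring n q → Subset n → Set} (P? : ∀ c e → Dec (P c e)) (H : Hypergraph n) →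
    length (filter (λ c → All.all? (P? c) H) (allColorings n q))
      ≡ ∑ᶜ n (λ c → product (map (λ e → 𝟙 (does (P? c e))) H))
  count-All {n} P? H =
    trans (length-filter-∑ˡ (λ c → All.all? (P? c) H) (allColorings n q)) (∑ᶜ-cong n (λ c → 𝟙-All (P? c) H))

  edge-family-bound : ∀ {n} k → 1 ≤ k → {P : Coloring n q → Subset n → Set} (P? : ∀ c e → Dec (P c e)) →
    (∀ e → DependsOn e (λ c → does (P? c e))) → (E : Fin n → Subset n) (X : ℕ) →
    (∀ i → ∑ n (λ v → 𝟙 (lookup (E v) i)) ≡ k) → (∀ v → ∑on (E v) (λ c → 𝟙 (does (P? c (E v)))) ≡ X) →
    ∑ᶜ n (λ c → product (map (λ e → 𝟙 (does (P? c e))) (map E (allFin n)))) ^ k ≤ X ^ n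
  edge-family-bound {n} k k≥1 P? local E X covered count =
    subst₂ (λ a b → a ^ k ≤ b) (∑ᶜ-cong n passes) bound (finner n tests covered′)
    where
    open Finner q d k k≥1
    edgeTest : Fin n → LocalTest n
    edgeTest v = test (E v) (λ c → does (P? c (E v))) (local (E v))
    tests : List (LocalTest n)
    tests = map edgeTest (allFin n)
    passes : ∀ c → passesAll tests c ≡ product (map (λ e → 𝟙 (does (P? c e))) (map E (allFin n)))
    passes c = cong product (trans (sym (Listₚ.map-∘ (allFin n))) (Listₚ.map-∘ (allFin n)))
    covered′ : ∀ i → coverage tests i ≡ k
    covered′ i = trans (cong sum (sym (Listₚ.map-∘ (allFin n)))) (trans (sum-map-tabulate n id _) (covered i))
    bound : finnerBound tests ≡ X ^ n
    bound = trans (cong product (sym (Listₚ.map-∘ (allFin n)))) (product-map-tabulate n id _ X count)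

  single-edge-count : ∀ {m} → 1 ≤ m → {P : Coloring m q → Subset m → Set} (P? : ∀ c e → Dec (P c e)) →
    (E : Fin m → Subset m) → (∀ v → E v ≡ replicate m true) →
    length (filter (λ c → All.all? (P? c) (map E (allFin m))) (allColorings m q))
      ≡ ∑on (replicate m true) (λ c → 𝟙 (does (P? c (replicate m true))))
  single-edge-count {m} m≥1 P? E full = trans (count-All P? (map E (allFin m)))
    (trans (∑ᶜ-cong m (λ c → trans (cong product (sym (Listₚ.map-∘ (allFin m))))
             (trans (product-map-tabulate m id _ _ (λ v → cong (λ e → 𝟙 (does (P? c e))) (full v)))
                    (𝟙-^ _ m m≥1))))
           (∑ᶜ-∑on m _))

  -- A hypergraph whose edges take exactly two values H₁, H₂ partitioning the vertex
  -- set: the conditions on H₁ and on H₂ are independent.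
  two-edge-count : ∀ {n} {P : Coloring n q → Subset n → Set} (P? : ∀ c e → Dec (P c e)) →
    (∀ e → DependsOn e (λ c → does (P? c e))) → (E : Fin n → Subset n) (H₁ H₂ : Subset n) →
    (∀ v → E v ≡ H₁ ⊎ E v ≡ H₂) → (v₁ v₂ : Fin n) → E v₁ ≡ H₁ → E v₂ ≡ H₂ →
    (∀ i → lookup (replicate n true) i ≡ (lookup H₁ i ∨ lookup H₂ i)) → (∀ i → (lookup H₁ i ∧ lookup H₂ i) ≡ false) →
    length (filter (λ c → All.all? (P? c) (map E (allFin n))) (allColorings n q))
      ≡ ∑on H₁ (λ c → 𝟙 (does (P? c H₁))) * ∑on H₂ (λ c → 𝟙 (does (P? c H₂)))
  two-edge-count {n} {P} P? local E H₁ H₂ two-valued v₁ v₂ E₁ E₂ union disjoint =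
    trans (length-filter-∑ˡ (λ c → All.all? (P? c) (map E (allFin n))) (allColorings n q)) (trans (∑ᶜ-cong n (λ c →
      𝟙-× (split c) (join c) (All.all? (P? c) (map E (allFin n))) (P? c H₁) (P? c H₂)))
      (trans (∑ᶜ-∑on n _) (∑on-* H₁ H₂ (replicate n true) _ _ (DependsOn-∘ {S = H₁} 𝟙 (local H₁)) (DependsOn-∘ {S = H₂} 𝟙 (local H₂)) union disjoint)))
    where
    split : ∀ c → All (P c) (map E (allFin n)) → P c H₁ × P c H₂
    split c all = subst (P c) E₁ (at v₁) , subst (P c) E₂ (at v₂)
      where
      at : ∀ v → P c (E v)
      at = Allₚ.tabulate⁻ (Allₚ.map⁻ all)
    join : ∀ c → P c H₁ × P c H₂ → All (P c) (map E (allFin n))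
    join c (p₁ , p₂) = Allₚ.map⁺ (Allₚ.tabulate⁺ at)
      where
      at : ∀ v → P c (E v)
      at v with two-valued v
      ... | inj₁ Ev≡H₁ = subst (P c) (sym Ev≡H₁) p₁
      ... | inj₂ Ev≡H₂ = subst (P c) (sym Ev≡H₂) p₂

  module _ {n} (E : Fin n → Subset n) (symmetric : ∀ v i → lookup (E v) i ≡ lookup (E i) v)
           (k : ℕ) (k≥1 : 1 ≤ k) (uniform : ∀ v → ∣ E v ∣ ≡ k) where
    open EdgeCounts q d

    χ-uniform-bound : χ (map E (allFin n)) q ^ k ≤ (q ^ k ∸ q) ^ n
    χ-uniform-bound = subst (λ z → z ^ k ≤ (q ^ k ∸ q) ^ n) (sym (count-All (λ c e → ¬? (mono? c e)) (map E (allFin n))))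
      (edge-family-bound k k≥1 (λ c e → ¬? (mono? c e)) properOn-local E (q ^ k ∸ q)
        (λ i → trans (symmetric-coverage E symmetric i) (uniform i))
        (λ v → trans (∑on-properOn (E v) (subst (1 ≤_) (sym (uniform v)) k≥1)) (cong (λ z → q ^ z ∸ q) (uniform v))))

    χ˘-uniform-bound : χ˘ (map E (allFin n)) q ^ k ≤ fall q k ^ n
    χ˘-uniform-bound = subst (λ z → z ^ k ≤ fall q k ^ n) (sym (count-All rainbowEdge? (map E (allFin n))))
      (edge-family-bound k k≥1 rainbowEdge? rainbowOn-local E (fall q k)
        (λ i → trans (symmetric-coverage E symmetric i) (uniform i))
        (λ v → trans (∑on-rainbowOn (E v)) (cong (fall q) (uniform v))))

N-symmetric : ∀ {n} (G : Graph n) v i → lookup (N G v) i ≡ lookup (N G i) v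
N-symmetric G v i =
  trans (Vecₚ.lookup∘tabulate (adj G v) i) (trans (adj-sym G v i) (sym (Vecₚ.lookup∘tabulate (adj G i) v)))

Nc-symmetric : ∀ {n} (G : Graph n) v i → lookup (Nc G v) i ≡ lookup (Nc G i) v
Nc-symmetric G v i with i Fin.≟ v
... | yes refl = refl
... | no i≢v   = trans (Vecₚ.lookup∘update′ i≢v (N G v) true)
                   (trans (N-symmetric G v i) (sym (Vecₚ.lookup∘update′ (i≢v ∘ sym) (N G i) true)))

∣Nc∣ : ∀ {n} r (G : Graph n) → Regular r G → ∀ v → ∣ Nc G v ∣ ≡ r + 1
∣Nc∣ r G regular v = trans (∣[]≔true∣ (N G v) v (trans (Vecₚ.lookup∘tabulate (adj G v) v) (irrefl G v)))
                            (trans (cong suc (regular v)) (+-comm 1 r))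

Nc-complete : ∀ m v → Nc (Kₙ m) v ≡ replicate m true
Nc-complete m v = lookup-ext entry
  where
  entry : ∀ i → lookup (Nc (Kₙ m) v) i ≡ lookup (replicate m true) i
  entry i with i Fin.≟ v
  ... | yes refl = trans (Vecₚ.lookup∘update i (N (Kₙ m) i) true) (sym (Vecₚ.lookup-replicate i true))
  ... | no i≢v   = trans (Vecₚ.lookup∘update′ i≢v (N (Kₙ m) v) true)
                     (trans (Vecₚ.lookup∘tabulate (adj (Kₙ m) v) i)
                       (trans (cong not (does-no (i≢v ∘ sym) (v Fin.≟ i))) (sym (Vecₚ.lookup-replicate i true))))

module CompleteBipartite (r : ℕ) where

  part₁ : Subset (r + r)
  part₁ = tabulate (side r)

  part₂ : Subset (r + r)
  part₂ = tabulate (not ∘ side r)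

  N-in-part₁ : ∀ v → side r v ≡ true → N (Kbip r) v ≡ part₂
  N-in-part₁ v v∈₁ = lookup-ext λ i → trans (Vecₚ.lookup∘tabulate (adj (Kbip r) v) i)
    (trans (cong (_xor side r i) v∈₁) (sym (Vecₚ.lookup∘tabulate (not ∘ side r) i)))

  N-in-part₂ : ∀ v → side r v ≡ false → N (Kbip r) v ≡ part₁
  N-in-part₂ v v∈₂ = lookup-ext λ i → trans (Vecₚ.lookup∘tabulate (adj (Kbip r) v) i)
    (trans (cong (_xor side r i) v∈₂) (sym (Vecₚ.lookup∘tabulate (side r) i)))

  N-two-valued : ∀ v → N (Kbip r) v ≡ part₁ ⊎ N (Kbip r) v ≡ part₂
  N-two-valued v = by-side (side r v) refl
    where
    by-side : ∀ b → side r v ≡ b → N (Kbip r) v ≡ part₁ ⊎ N (Kbip r) v ≡ part₂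
    by-side true  v∈₁ = inj₂ (N-in-part₁ v v∈₁)
    by-side false v∈₂ = inj₁ (N-in-part₂ v v∈₂)

  side-↑ʳ : ∀ s {m} (i : Fin m) → side s (s ↑ʳ i) ≡ false
  side-↑ʳ zero    i = refl
  side-↑ʳ (suc s) i = side-↑ʳ s i

  ∑-side : ∀ s m → ∑ (s + m) (𝟙 ∘ side s) ≡ s
  ∑-side zero    m = ∑-zero m _ (λ _ → refl)
  ∑-side (suc s) m = cong suc (∑-side s m)

  ∣part₁∣ : ∣ part₁ ∣ ≡ r
  ∣part₁∣ = trans (∣∣-∑ part₁) (trans (∑-cong (r + r) (λ i → cong 𝟙 (Vecₚ.lookup∘tabulate (side r) i))) (∑-side r r))

  ∣part₂∣ : ∣ part₂ ∣ ≡ r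
  ∣part₂∣ = begin
    ∣ part₂ ∣                              ≡⟨ ∣∣-∑ part₂ ⟩
    ∑ (r + r) (𝟙 ∘ lookup part₂)          ≡⟨ ∑-cong (r + r) (λ i → cong 𝟙 complement) ⟩
    ∑ (r + r) (𝟙 ∘ not ∘ lookup part₁)    ≡⟨ ∑-not (r + r) part₁ ⟩
    r + r ∸ ∣ part₁ ∣                      ≡⟨ cong (r + r ∸_) ∣part₁∣ ⟩
    r + r ∸ r                              ≡⟨ m+n∸m≡n r r ⟩
    r                                      ∎
    where
    open ≡-Reasoning
    complement : ∀ {i} → lookup part₂ i ≡ not (lookup part₁ i)
    complement {i} = trans (Vecₚ.lookup∘tabulate (not ∘ side r) i) (cong not (sym (Vecₚ.lookup∘tabulate (side r) i)))

  parts-union : ∀ i → lookup (replicate (r + r) true) i ≡ (lookup part₁ i ∨ lookup part₂ i)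
  parts-union i rewrite Vecₚ.lookup-replicate i true | Vecₚ.lookup∘tabulate (side r) i
                      | Vecₚ.lookup∘tabulate (not ∘ side r) i with side r i
  ... | true  = refl
  ... | false = refl

  parts-disjoint : ∀ i → (lookup part₁ i ∧ lookup part₂ i) ≡ false
  parts-disjoint i rewrite Vecₚ.lookup∘tabulate (side r) i | Vecₚ.lookup∘tabulate (not ∘ side r) i
    with side r i
  ... | true  = refl
  ... | false = refl

module ExtremalCounts (q : ℕ) (d : Fin q) where
  open ColouringSums q d
  open EdgeCounts q d
  open HypergraphCounts q d

  χ-complete : ∀ m → 1 ≤ m → χ (𝒩c (Kₙ m)) q ≡ q ^ m ∸ q
  χ-complete m m≥1 = begin
    χ (𝒩c (Kₙ m)) q                           ≡⟨ single-edge-count m≥1 (λ c e → ¬? (mono? c e)) (Nc (Kₙ m)) (Nc-complete m) ⟩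
    ∑on full (𝟙 ∘ properOn full)             ≡⟨ ∑on-properOn full (subst (1 ≤_) (sym (Subsetₚ.∣⊤∣≡n m)) m≥1) ⟩
    q ^ ∣ full ∣ ∸ q                           ≡⟨ cong (λ z → q ^ z ∸ q) (Subsetₚ.∣⊤∣≡n m) ⟩
    q ^ m ∸ q                                  ∎
    where
    open ≡-Reasoning
    full : Subset m
    full = replicate m true

  χ˘-complete : ∀ m → 1 ≤ m → χ˘ (𝒩c (Kₙ m)) q ≡ fall q m
  χ˘-complete m m≥1 = begin
    χ˘ (𝒩c (Kₙ m)) q                          ≡⟨ single-edge-count m≥1 rainbowEdge? (Nc (Kₙ m)) (Nc-complete m) ⟩
    ∑on full (𝟙 ∘ rainbowOn full)            ≡⟨ ∑on-rainbowOn full ⟩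
    fall q ∣ full ∣                            ≡⟨ cong (fall q) (Subsetₚ.∣⊤∣≡n m) ⟩
    fall q m                                   ∎
    where
    open ≡-Reasoning
    full : Subset m
    full = replicate m true

  bipartite-count : ∀ r → 1 ≤ r → {P : Coloring (r + r) q → Subset (r + r) → Set} (P? : ∀ c e → Dec (P c e)) →
    (∀ e → DependsOn e (λ c → does (P? c e))) →
    length (filter (λ c → All.all? (P? c) (𝒩 (Kbip r))) (allColorings (r + r) q))
      ≡ ∑on (CompleteBipartite.part₁ r) (λ c → 𝟙 (does (P? c (CompleteBipartite.part₁ r))))
      * ∑on (CompleteBipartite.part₂ r) (λ c → 𝟙 (does (P? c (CompleteBipartite.part₂ r))))
  bipartite-count r@(suc _) _ P? local = two-edge-count P? local (N (Kbip r)) part₁ part₂ N-two-valued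
    (r ↑ʳ zero) zero (N-in-part₂ (r ↑ʳ zero) (side-↑ʳ r zero)) (N-in-part₁ zero refl) parts-union parts-disjoint
    where open CompleteBipartite r

  χ-bipartite : ∀ r → 1 ≤ r → χ (𝒩 (Kbip r)) q ≡ (q ^ r ∸ q) ^ 2
  χ-bipartite r r≥1 = begin
    χ (𝒩 (Kbip r)) q
      ≡⟨ bipartite-count r r≥1 (λ c e → ¬? (mono? c e)) properOn-local ⟩
    ∑on part₁ (𝟙 ∘ properOn part₁) * ∑on part₂ (𝟙 ∘ properOn part₂)
      ≡⟨ cong₂ _*_ (∑on-properOn part₁ (subst (1 ≤_) (sym ∣part₁∣) r≥1))
                   (∑on-properOn part₂ (subst (1 ≤_) (sym ∣part₂∣) r≥1)) ⟩
    (q ^ ∣ part₁ ∣ ∸ q) * (q ^ ∣ part₂ ∣ ∸ q)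
      ≡⟨ cong₂ (λ a b → (q ^ a ∸ q) * (q ^ b ∸ q)) ∣part₁∣ ∣part₂∣ ⟩
    (q ^ r ∸ q) * (q ^ r ∸ q)
      ≡⟨ cong ((q ^ r ∸ q) *_) (*-identityʳ (q ^ r ∸ q)) ⟨
    (q ^ r ∸ q) ^ 2 ∎
    where
    open ≡-Reasoning
    open CompleteBipartite r

  χ˘-bipartite : ∀ r → 1 ≤ r → χ˘ (𝒩 (Kbip r)) q ≡ fall q r ^ 2
  χ˘-bipartite r r≥1 = begin
    χ˘ (𝒩 (Kbip r)) q
      ≡⟨ bipartite-count r r≥1 rainbowEdge? rainbowOn-local ⟩
    ∑on part₁ (𝟙 ∘ rainbowOn part₁) * ∑on part₂ (𝟙 ∘ rainbowOn part₂)
      ≡⟨ cong₂ _*_ (∑on-rainbowOn part₁) (∑on-rainbowOn part₂) ⟩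
    fall q ∣ part₁ ∣ * fall q ∣ part₂ ∣
      ≡⟨ cong₂ (λ a b → fall q a * fall q b) ∣part₁∣ ∣part₂∣ ⟩
    fall q r * fall q r
      ≡⟨ cong (fall q r *_) (*-identityʳ (fall q r)) ⟨
    fall q r ^ 2 ∎
    where
    open ≡-Reasoning
    open CompleteBipartite r

square-bound : ∀ x X k n → x ^ k ≤ X ^ n → x ^ (2 * k) ≤ (X ^ 2) ^ n
square-bound x X k n bound = subst₂ _≤_
  (trans (^-*-assoc x k 2) (cong (x ^_) (*-comm k 2)))
  (trans (^-*-assoc X n 2) (trans (cong (X ^_) (*-comm n 2)) (sym (^-*-assoc X 2 n))))
  (^-monoˡ-≤ 2 bound)

mainTheorem4 : (r n q : ℕ) → 1 ≤ r → 1 ≤ q →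
    (G : Graph n) → Regular r G →
    ((χ (𝒩 G) q ^ (2 * r) ≤ χ (𝒩 (Kbip r)) q ^ n)
    × (χ (𝒩 (Kbip r)) q ≡ (q ^ r ∸ q) ^ 2))
    × ((χ (𝒩c G) q ^ (r + 1) ≤ χ (𝒩c (Kₙ (r + 1))) q ^ n)
    × (χ (𝒩c (Kₙ (r + 1))) q ≡ q ^ (r + 1) ∸ q))
    × ((χ˘ (𝒩 G) q ^ (2 * r) ≤ χ˘ (𝒩 (Kbip r)) q ^ n)
    × (χ˘ (𝒩 (Kbip r)) q ≡ fall q r ^ 2))
    × ((χ˘ (𝒩c G) q ^ (r + 1) ≤ χ˘ (𝒩c (Kₙ (r + 1))) q ^ n)
    × (χ˘ (𝒩c (Kₙ (r + 1))) q ≡ fall q (r + 1)))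
mainTheorem4 r n q@(suc _) r≥1 _ G regular =
    (rebase χ-Kbip (square-bound _ _ r n (χ-uniform-bound (N G) (N-symmetric G) r r≥1 regular)) , χ-Kbip)
  , (rebase χ-K (χ-uniform-bound (Nc G) (Nc-symmetric G) (r + 1) r+1≥1 ∣Nc∣≡) , χ-K)
  , (rebase χ˘-Kbip (square-bound _ _ r n (χ˘-uniform-bound (N G) (N-symmetric G) r r≥1 regular)) , χ˘-Kbip)
  , (rebase χ˘-K (χ˘-uniform-bound (Nc G) (Nc-symmetric G) (r + 1) r+1≥1 ∣Nc∣≡) , χ˘-K)
  where
  open HypergraphCounts q zero
  open ExtremalCounts q zero
  r+1≥1 : 1 ≤ r + 1
  r+1≥1 = m≤n+m 1 r
  ∣Nc∣≡ : ∀ v → ∣ Nc G v ∣ ≡ r + 1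
  ∣Nc∣≡ = ∣Nc∣ r G regular
  χ-Kbip : χ (𝒩 (Kbip r)) q ≡ (q ^ r ∸ q) ^ 2
  χ-Kbip = χ-bipartite r r≥1
  χ˘-Kbip : χ˘ (𝒩 (Kbip r)) q ≡ fall q r ^ 2
  χ˘-Kbip = χ˘-bipartite r r≥1
  χ-K : χ (𝒩c (Kₙ (r + 1))) q ≡ q ^ (r + 1) ∸ q
  χ-K = χ-complete (r + 1) r+1≥1
  χ˘-K : χ˘ (𝒩c (Kₙ (r + 1))) q ≡ fall q (r + 1)
  χ˘-K = χ˘-complete (r + 1) r+1≥1
  rebase : ∀ {a X Y} → Y ≡ X → a ≤ X ^ n → a ≤ Y ^ n
  rebase refl bound = bound
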